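{- For every integer $p\ge 2$, $\mu(H(p))=\frac{158p^4-35p^2-3}{120p^3-30p}$.
   Context: For a connected graph $G$ on $N\ge 2$ vertices, $W(G)=\sum_{\{u,v\}\subseteq V(G)} d_G(u,v)$ (unordered pairs of distinct vertices) and the average distance is $\mu(G)=\frac{2W(G)}{N(N-1)}$. The hexagonal square-cell configuration $H(p)$ is the subgraph of the square lattice formed as follows: let $n=3p-2$ and $a=p-1$; for integers $x,r$ let $C(x,r)=[x,x+1]\times[r,r+1]$; take cell rows $r=0,\dots,2a$ with $x$-ranges $L_r\le x\le R_r$ given by $L_r=-r$, $R_r=p-1+r$ for $0\le r\le a-1$; $L_a=-a$, $R_a=-a+n-1$; and for $r=a+1+l$, $0\le l\le a-1$, $L_r=1-a+l$, $R_r=n-2-a-l$. $H(p)$ is the graph whose vertices are the corners and whose edges are the sides of these squares (cell rows of widths $p,p+2,\dots,3p-4,3p-2,3p-4,\dots,p$, centered; it has $4p^2$ vertices). -}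

module Defs where

open import Data.Nat as ℕ using (ℕ; zero; suc; _∸_; _<ᵇ_; _≡ᵇ_)
open import Data.Integer as ℤ using (ℤ; +_; -_; _+_; _-_; ∣_∣)
open import Data.Bool using (if_then_else_)
open import Data.Product using (_×_; _,_)
open import Data.Product.Properties using (≡-dec)
open import Data.List using (List; []; _∷_; map; concatMap; applyUpTo; deduplicate)
open import Data.Nat.ListAction using (sum)
open import Data.List.Membership.Propositional using (_∈_)
open import Data.List.Relation.Unary.Any using (Any)
open import Data.Sum using (_⊎_)
open import Relation.Binary.PropositionalEquality using (_≡_)
open import Relation.Nullary using (Dec)

Pt : Set
Pt = ℤ × ℤ

aP : ℕ → ℕ
aP p = p ∸ 1

nP : ℕ → ℕ
nP p = 3 ℕ.* p ∸ 2

Lrow : ℕ → ℕ → ℤ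
Lrow p r =
  if r <ᵇ aP p then - (+ r)
  else if r ≡ᵇ aP p then - (+ aP p)
  else (+ 1) - (+ aP p) + (+ (r ∸ (aP p ℕ.+ 1)))

Rrow : ℕ → ℕ → ℤ
Rrow p r =
  if r <ᵇ aP p then (+ p) - (+ 1) + (+ r)
  else if r ≡ᵇ aP p then - (+ aP p) + (+ nP p) - (+ 1)
  else (+ nP p) - (+ 2) - (+ aP p) - (+ (r ∸ (aP p ℕ.+ 1)))

zrange : ℤ → ℕ → List ℤ
zrange s k = applyUpTo (λ i → s + (+ i)) k

-- cells C(x,r) of row r, encoded by their lower-left corner (x, r), for L_r ≤ x ≤ R_r
rowCells : ℕ → ℕ → List Pt
rowCells p r = map (λ x → (x , + r)) (zrange (Lrow p r) (∣ Rrow p r - Lrow p r ∣ ℕ.+ 1))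

cells : ℕ → List Pt
cells p = concatMap (rowCells p) (applyUpTo (λ r → r) (2 ℕ.* aP p ℕ.+ 1))

corners : Pt → List Pt
corners (x , y) = (x , y) ∷ (x + + 1 , y) ∷ (x , y + + 1) ∷ (x + + 1 , y + + 1) ∷ []

sides : Pt → List (Pt × Pt)
sides (x , y) =
  ((x , y) , (x + + 1 , y)) ∷ ((x , y + + 1) , (x + + 1 , y + + 1)) ∷
  ((x , y) , (x , y + + 1)) ∷ ((x + + 1 , y) , (x + + 1 , y + + 1)) ∷ []

_≟P_ : (u v : Pt) → Dec (u ≡ v)
_≟P_ = ≡-dec ℤ._≟_ ℤ._≟_

vertices : ℕ → List Pt
vertices p = deduplicate _≟P_ (concatMap corners (cells p))

Adj : ℕ → Pt → Pt → Set
Adj p u v = Any (λ c → ((u , v) ∈ sides c) ⊎ ((v , u) ∈ sides c)) (cells p)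

data Walk (p : ℕ) : Pt → Pt → ℕ → Set where
  here : ∀ {u} → Walk p u u zero
  step : ∀ {u w v k} → Adj p u w → Walk p w v k → Walk p u v (suc k)

IsDistance : ℕ → (Pt → Pt → ℕ) → Set
IsDistance p d = ∀ u v → u ∈ vertices p → v ∈ vertices p →
  Walk p u v (d u v) × (∀ k → Walk p u v k → d u v ℕ.≤ k)

pairSum : (Pt → Pt → ℕ) → List Pt → ℕ
pairSum f [] = 0
pairSum f (x ∷ xs) = sum (map (f x) xs) ℕ.+ pairSum f xs

wiener : ℕ → (Pt → Pt → ℕ) → ℕ
wiener p d = pairSum d (vertices p)

{-# OPTIONS --safe #-}
module Submission where

-- A vertex row k of H(p) and its mirror row 2p - 1 - k both span x = -k, ..., p + k.  Between
-- two vertices one can first move vertically in the column of the endpoint on the narrower row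
-- and then horizontally without leaving H(p), so the graph distance is the Manhattan distance.
-- Summing it over pairs of rows: the horizontal part for two nested rows is a difference of
-- (shifted) tetrahedral numbers, the vertical part a product of row lengths, and adding up these
-- cubic polynomials gives 2 W(H(p)) = 2p (158p⁴ - 35p² - 3) / 15, while H(p) has 4p² vertices.

module Summation where

  open import Data.Nat using (ℕ; zero; suc; _+_; _*_; ∣_-_∣)
  open import Data.Nat.Properties
  open import Data.Nat.ListAction using (sum)
  open import Data.Nat.ListAction.Properties using (sum-++)
  open import Data.List using ([]; _∷_; applyUpTo; _∷ʳ_)
  open import Data.List.Properties using (applyUpTo-∷ʳ)
  open import Data.Nat.Tactic.RingSolver using (solve-∀)
  open import Algebra.Properties.CommutativeSemigroup +-commutativeSemigroup using (interchange; xy∙z≈xz∙y)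
  open import Function using (_∘′_)
  open import Relation.Binary.PropositionalEquality

  ∑< : ℕ → (ℕ → ℕ) → ℕ
  ∑< n f = sum (applyUpTo f n)

  syntax ∑< n (λ i → e) = ∑[ i < n ] e

  ∑-suc : ∀ n f → ∑< (suc n) f ≡ ∑< n f + f n
  ∑-suc n f = begin
    sum (applyUpTo f (suc n))   ≡⟨ cong sum (applyUpTo-∷ʳ f n) ⟨
    sum (applyUpTo f n ∷ʳ f n)  ≡⟨ sum-++ (applyUpTo f n) (f n ∷ []) ⟩
    ∑< n f + (f n + 0)          ≡⟨ cong (_+_ (∑< n f)) (+-identityʳ (f n)) ⟩
    ∑< n f + f n                ∎
    where open ≡-Reasoning

  applyUpTo-cong : ∀ {A : Set} {f g : ℕ → A} → (∀ i → f i ≡ g i) → ∀ n → applyUpTo f n ≡ applyUpTo g n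
  applyUpTo-cong f≗g zero    = refl
  applyUpTo-cong f≗g (suc n) = cong₂ _∷_ (f≗g 0) (applyUpTo-cong (λ i → f≗g (suc i)) n)

  ∑-cong : ∀ n {f g} → (∀ i → f i ≡ g i) → ∑< n f ≡ ∑< n g
  ∑-cong n f≗g = cong sum (applyUpTo-cong f≗g n)

  ∑-+ : ∀ n f g → ∑[ i < n ] (f i + g i) ≡ ∑< n f + ∑< n g
  ∑-+ zero    f g = refl
  ∑-+ (suc n) f g = trans (cong (_+_ (f 0 + g 0)) (∑-+ n (f ∘′ suc) (g ∘′ suc)))
                          (interchange (f 0) (g 0) (∑< n (f ∘′ suc)) (∑< n (g ∘′ suc)))

  ∑-const : ∀ n c → ∑[ i < n ] c ≡ n * c
  ∑-const zero    c = refl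
  ∑-const (suc n) c = cong (_+_ c) (∑-const n c)

  triangular : ℕ → ℕ
  triangular zero    = 0
  triangular (suc n) = triangular n + suc n

  triangular-closed : ∀ n → 2 * triangular n ≡ n * suc n
  triangular-closed zero    = refl
  triangular-closed (suc n) = begin
    2 * (triangular n + suc n)        ≡⟨ *-distribˡ-+ 2 (triangular n) (suc n) ⟩
    2 * triangular n + 2 * suc n      ≡⟨ cong (λ t → t + 2 * suc n) (triangular-closed n) ⟩
    n * suc n + 2 * suc n             ≡⟨ step n ⟩
    suc n * suc (suc n)               ∎
    where
    open ≡-Reasoning
    step : ∀ n → n * suc n + 2 * suc n ≡ suc n * suc (suc n)
    step = solve-∀

  triangularSum : ℕ → ℕ
  triangularSum zero    = 0
  triangularSum (suc n) = triangularSum n + triangular n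

  ∑∣i-j∣-point : ∀ a t → ∑[ j < suc (a + t) ] ∣ a - j ∣ ≡ triangular a + triangular t
  ∑∣i-j∣-point zero    t = ∑-upTo t
    where
    ∑-upTo : ∀ t → ∑[ j < suc t ] j ≡ triangular t
    ∑-upTo zero    = refl
    ∑-upTo (suc t) = trans (∑-suc (suc t) (λ j → j)) (cong (_+ suc t) (∑-upTo t))
  ∑∣i-j∣-point (suc a) t = begin
    suc a + ∑[ j < suc (a + t) ] ∣ a - j ∣   ≡⟨ cong (_+_ (suc a)) (∑∣i-j∣-point a t) ⟩
    suc a + (triangular a + triangular t)    ≡⟨ shuffle (suc a) (triangular a) (triangular t) ⟩
    triangular a + suc a + triangular t      ∎
    where
    open ≡-Reasoning
    shuffle : ∀ x y z → x + (y + z) ≡ y + x + z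
    shuffle = solve-∀

  -- The last index i = m is the point m + s of the range of j, which extends t beyond it; hence
  -- the induction on m with t generalised.
  ∑∣i-j∣-segment : ∀ s m t →
    ∑[ i < m ] ∑[ j < s + m + t ] ∣ i + s - j ∣ + triangularSum s + triangularSum t
      ≡ triangularSum (s + m) + triangularSum (m + t)
  ∑∣i-j∣-segment s zero    t = cong (λ x → triangularSum x + triangularSum t) (sym (+-identityʳ s))
  ∑∣i-j∣-segment s (suc m) t = begin
    rows (s + suc m + t) (suc m) + Te s + Te t
      ≡⟨ cong (λ r → r + Te s + Te t) (∑-suc m (λ i → row (s + suc m + t) i)) ⟩
    rows (s + suc m + t) m + row (s + suc m + t) m + Te s + Te t
      ≡⟨ cong₂ (λ l r → rows l m + row r m + Te s + Te t) (+-suc-middle s m t) (+-suc-left s m t) ⟩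
    rows (s + m + suc t) m + row (suc (m + s + t)) m + Te s + Te t
      ≡⟨ cong (λ r → rows (s + m + suc t) m + r + Te s + Te t) (∑∣i-j∣-point (m + s) t) ⟩
    rows (s + m + suc t) m + (T (m + s) + T t) + Te s + Te t
      ≡⟨ regroup (rows (s + m + suc t) m) (T (m + s)) (T t) (Te s) (Te t) ⟩
    rows (s + m + suc t) m + Te s + Te (suc t) + T (m + s)
      ≡⟨ cong (_+ T (m + s)) (∑∣i-j∣-segment s m (suc t)) ⟩
    Te (s + m) + Te (m + suc t) + T (m + s)
      ≡⟨ cong₂ (λ x y → Te (s + m) + Te x + T y) (+-suc m t) (+-comm m s) ⟩
    Te (s + m) + Te (suc m + t) + T (s + m)
      ≡⟨ xy∙z≈xz∙y (Te (s + m)) (Te (suc m + t)) (T (s + m)) ⟩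
    Te (suc (s + m)) + Te (suc m + t)
      ≡⟨ cong (λ x → Te x + Te (suc m + t)) (+-suc s m) ⟨
    Te (s + suc m) + Te (suc m + t) ∎
    where
    open ≡-Reasoning
    T : ℕ → ℕ
    T = triangular
    Te : ℕ → ℕ
    Te = triangularSum
    row : ℕ → ℕ → ℕ
    row l i = ∑[ j < l ] ∣ i + s - j ∣
    rows : ℕ → ℕ → ℕ
    rows l m = ∑[ i < m ] row l i
    +-suc-middle : ∀ s m t → s + suc m + t ≡ s + m + suc t
    +-suc-middle = solve-∀
    +-suc-left : ∀ s m t → s + suc m + t ≡ suc (m + s + t)
    +-suc-left = solve-∀
    regroup : ∀ r a b c d → r + (a + b) + c + d ≡ r + c + (d + b) + a
    regroup = solve-∀

module ClosedForms where

  open import Data.Nat using (ℕ)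
  open import Data.Integer using (ℤ; +_; _+_; _-_; _*_)
  open import Data.Integer.Solver using (module +-*-Solver)
  open +-*-Solver using (solve; _:=_; Polynomial; con; _:+_; _:-_; _:*_)
  open import Relation.Binary.PropositionalEquality using (_≡_; refl)

  -- The closed forms are written once, over an abstract ring syntax: read in ℤ they are the
  -- formulas, read in the polynomial syntax of the ring solver they let solve prove the identities
  -- between them.
  record RingSyntax (A : Set) : Set where
    infixl 6 _⊕_ _⊖_
    infixl 7 _⊛_
    infix 8 #_
    field
      #_ : ℕ → A
      _⊕_ _⊖_ _⊛_ : A → A → A

  module Formulas {A : Set} (R : RingSyntax A) where
    open RingSyntax R

    cube : A → A
    cube x = (x ⊖ # 1) ⊛ x ⊛ (x ⊕ # 1)

    rowLength : A → A → A
    rowLength q k = # 1 ⊕ q ⊕ k ⊕ k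

    -- 3 rowPairSum, 3 partialSum and 15 hexagonSum, respectively.
    rowPairFormula : A → A → A → A
    rowPairFormula q k n =
      # 4 ⊛ (cube (q ⊕ k ⊕ n ⊕ # 1) ⊖ cube (n ⊖ k))
        ⊕ # 6 ⊛ rowLength q k ⊛ rowLength q n ⊛ (# 2 ⊛ q ⊖ # 1 ⊖ # 2 ⊛ k)

    partialFormula : A → A → A → A
    partialFormula q n m =
      m ⊛ (# 2 ⊕ # 4 ⊛ n ⊕ # 12 ⊛ q ⊛ n ⊛ (n ⊕ # 1) ⊕ # 18 ⊛ q ⊛ q ⊛ (# 2 ⊛ n ⊕ # 1)
        ⊕ # 16 ⊛ q ⊛ q ⊛ q
        ⊕ m ⊛ (# 12 ⊛ (q ⊕ n) ⊛ (q ⊕ n ⊕ # 1) ⊖ # 2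
        ⊕ m ⊛ (# 2 ⊛ m ⊖ # 4 ⊛ (q ⊕ # 4 ⊛ n ⊕ # 2))))

    hexagonFormula : A → A → A
    hexagonFormula q n =
      # 2 ⊛ n ⊛ (# 40 ⊛ q ⊛ n ⊛ (q ⊕ n) ⊛ (q ⊕ n) ⊖ # 2 ⊛ n ⊛ n ⊛ n ⊛ n ⊖ # 10 ⊛ n ⊛ n
                   ⊖ # 20 ⊛ q ⊛ n ⊖ # 5 ⊛ q ⊛ q ⊖ # 3)

  ℤ-syntax : RingSyntax ℤ
  ℤ-syntax = record { #_ = +_ ; _⊕_ = _+_ ; _⊖_ = _-_ ; _⊛_ = _*_ }

  polynomial-syntax : ∀ m → RingSyntax (Polynomial m)
  polynomial-syntax m = record { #_ = λ c → con (+ c) ; _⊕_ = _:+_ ; _⊖_ = _:-_ ; _⊛_ = _:*_ }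

  open Formulas ℤ-syntax public
  private
    module Syn {m} = Formulas (polynomial-syntax m)
    module S {m} = RingSyntax (polynomial-syntax m)
  open S

  cube-suc : ∀ x → cube (+ 1 + x) ≡ cube x + + 3 * (x * (+ 1 + x))
  cube-suc = solve 1 (λ x → Syn.cube (# 1 ⊕ x) := Syn.cube x ⊕ # 3 ⊛ (x ⊛ (# 1 ⊕ x))) refl

  partialFormula-zero : ∀ q n → partialFormula q n (+ 0) ≡ + 0
  partialFormula-zero = solve 2 (λ q n → Syn.partialFormula q n (# 0) := # 0) refl

  partialFormula-suc : ∀ q n m → partialFormula q n (+ 1 + m) ≡ partialFormula q n m + rowPairFormula q m n
  partialFormula-suc = solve 3 (λ q n m → Syn.partialFormula q n (# 1 ⊕ m)
    := Syn.partialFormula q n m ⊕ Syn.rowPairFormula q m n) refl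

  hexagonFormula-zero : ∀ q → hexagonFormula q (+ 0) ≡ + 0
  hexagonFormula-zero = solve 1 (λ q → Syn.hexagonFormula q (# 0) := # 0) refl

  hexagonFormula-suc : ∀ q n →
    hexagonFormula q (+ 1 + n) ≡ hexagonFormula q n + + 10 * partialFormula q n n + + 5 * rowPairFormula q n n
  hexagonFormula-suc = solve 2 (λ q n → Syn.hexagonFormula q (# 1 ⊕ n)
    := Syn.hexagonFormula q n ⊕ # 10 ⊛ Syn.partialFormula q n n ⊕ # 5 ⊛ Syn.rowPairFormula q n n) refl

  rowPairFormula-split : ∀ k d e → let q = + 1 + (k + d) + e ; c = + 1 + d + e + e in
    + 4 * (cube (d + rowLength q k) - cube d) + + 3 * (rowLength q k * (rowLength q (k + d) * (d + c + c + d)))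
      ≡ rowPairFormula q k (k + d)
  rowPairFormula-split = solve 3 (λ k d e → let q = # 1 ⊕ (k ⊕ d) ⊕ e ; c = # 1 ⊕ d ⊕ e ⊕ e in
    # 4 ⊛ (Syn.cube (d ⊕ Syn.rowLength q k) ⊖ Syn.cube d)
      ⊕ # 3 ⊛ (Syn.rowLength q k ⊛ (Syn.rowLength q (k ⊕ d) ⊛ (d ⊕ c ⊕ c ⊕ d)))
      := Syn.rowPairFormula q k (k ⊕ d)) refl

  hexagonFormula-diagonal : ∀ p → let l = + 4 * p * p in
    hexagonFormula p p * (+ 8 * p * p * p - + 2 * p)
      ≡ (+ 158 * p * p * p * p - + 35 * p * p - + 3) * (l * (l - + 1))
  hexagonFormula-diagonal = solve 1 (λ p → let l = # 4 ⊛ p ⊛ p in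
    Syn.hexagonFormula p p ⊛ (# 8 ⊛ p ⊛ p ⊛ p ⊖ # 2 ⊛ p)
      := (# 158 ⊛ p ⊛ p ⊛ p ⊛ p ⊖ # 35 ⊛ p ⊛ p ⊖ # 3) ⊛ (l ⊛ (l ⊖ # 1))) refl

module ListSums where

  open import Data.Nat using (ℕ; _+_; _*_)
  open import Data.Nat.Properties using (+-commutativeSemigroup)
  open import Data.List using (List; []; _∷_; _++_; map; applyUpTo)
  open import Data.List.Properties using (map-++; map-applyUpTo)
  open import Data.List.Membership.Propositional using (_∈_)
  open import Data.List.Relation.Unary.Any using (here; there)
  open import Data.List.Relation.Binary.Permutation.Propositional using (_↭_)
  open import Data.List.Relation.Binary.Permutation.Propositional.Properties using (map⁺)
  open import Data.Nat.ListAction using (sum)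
  open import Data.Nat.ListAction.Properties using (sum-++; sum-↭)
  open import Data.Nat.Tactic.RingSolver using (solve-∀)
  open import Algebra.Properties.CommutativeSemigroup +-commutativeSemigroup using (interchange)
  open import Relation.Binary.PropositionalEquality
  open import Defs using (Pt; pairSum)
  open Summation using (∑<; ∑-cong)

  sum-map-+ : ∀ {A : Set} (g h : A → ℕ) xs → sum (map (λ u → g u + h u) xs) ≡ sum (map g xs) + sum (map h xs)
  sum-map-+ g h []       = refl
  sum-map-+ g h (x ∷ xs) = trans (cong (_+_ (g x + h x)) (sum-map-+ g h xs)) (interchange (g x) (h x) _ _)

  sum-map-cong : ∀ {A : Set} {g h : A → ℕ} xs → (∀ u → u ∈ xs → g u ≡ h u) →
    sum (map g xs) ≡ sum (map h xs)
  sum-map-cong []       g≡h = refl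
  sum-map-cong (x ∷ xs) g≡h = cong₂ _+_ (g≡h x (here refl)) (sum-map-cong xs (λ u u∈xs → g≡h u (there u∈xs)))

  sum-map-++ : ∀ {A : Set} (g : A → ℕ) xs ys → sum (map g (xs ++ ys)) ≡ sum (map g xs) + sum (map g ys)
  sum-map-++ g xs ys = trans (cong sum (map-++ g xs ys)) (sum-++ (map g xs) (map g ys))

  crossSum : ∀ {A : Set} → (A → A → ℕ) → List A → List A → ℕ
  crossSum f xs ys = sum (map (λ u → sum (map (f u) ys)) xs)

  module _ {A : Set} (f : A → A → ℕ) where

    crossSum-++ˡ : ∀ xs ys zs → crossSum f (xs ++ ys) zs ≡ crossSum f xs zs + crossSum f ys zs
    crossSum-++ˡ xs ys zs = sum-map-++ (λ u → sum (map (f u) zs)) xs ys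

    crossSum-++ʳ : ∀ xs ys zs → crossSum f xs (ys ++ zs) ≡ crossSum f xs ys + crossSum f xs zs
    crossSum-++ʳ xs ys zs = trans (sum-map-cong xs (λ u _ → sum-map-++ (f u) ys zs))
                                  (sum-map-+ (λ u → sum (map (f u) ys)) (λ u → sum (map (f u) zs)) xs)

    crossSum-applyUpTo : ∀ a m b n → crossSum f (applyUpTo a m) (applyUpTo b n) ≡ ∑[ i < m ] ∑[ j < n ] f (a i) (b j)
    crossSum-applyUpTo a m b n = begin
      sum (map (λ u → sum (map (f u) (applyUpTo b n))) (applyUpTo a m))
        ≡⟨ cong sum (map-applyUpTo a (λ u → sum (map (f u) (applyUpTo b n))) m) ⟩
      ∑[ i < m ] sum (map (f (a i)) (applyUpTo b n))
        ≡⟨ ∑-cong m (λ i → cong sum (map-applyUpTo b (f (a i)) n)) ⟩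
      ∑[ i < m ] ∑[ j < n ] f (a i) (b j) ∎
      where open ≡-Reasoning

    crossSum-↭ : ∀ {xs xs′ ys ys′} → xs ↭ xs′ → ys ↭ ys′ → crossSum f xs ys ≡ crossSum f xs′ ys′
    crossSum-↭ {xs′ = xs′} {ys} xs↭xs′ ys↭ys′ =
      trans (sum-↭ (map⁺ (λ u → sum (map (f u) ys)) xs↭xs′))
            (sum-map-cong xs′ (λ u _ → sum-↭ (map⁺ (f u) ys↭ys′)))

    module _ (f-comm : ∀ u v → f u v ≡ f v u) where

      crossSum-comm : ∀ xs ys → crossSum f xs ys ≡ crossSum f ys xs
      crossSum-comm []       ys = sym (sum-map-zero ys)
        where
        sum-map-zero : ∀ ys → sum (map (λ _ → 0) ys) ≡ 0
        sum-map-zero []       = refl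
        sum-map-zero (_ ∷ ys) = sum-map-zero ys
      crossSum-comm (x ∷ xs) ys = begin
        sum (map (f x) ys) + crossSum f xs ys
          ≡⟨ cong₂ _+_ (sum-map-cong ys (λ u _ → f-comm x u)) (crossSum-comm xs ys) ⟩
        sum (map (λ u → f u x) ys) + crossSum f ys xs
          ≡⟨ sum-map-+ (λ u → f u x) (λ u → sum (map (f u) xs)) ys ⟨
        crossSum f ys (x ∷ xs) ∎
        where open ≡-Reasoning

  crossSum-diagonal : ∀ (f : Pt → Pt → ℕ) → (∀ u v → f u v ≡ f v u) → (∀ u → f u u ≡ 0) →
    ∀ xs → crossSum f xs xs ≡ 2 * pairSum f xs
  crossSum-diagonal f f-comm f-self []       = refl
  crossSum-diagonal f f-comm f-self (x ∷ xs) = begin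
    (f x x + row) + crossSum f xs (x ∷ xs)
      ≡⟨ cong (_+_ (f x x + row)) (sum-map-+ (λ u → f u x) (λ u → sum (map (f u) xs)) xs) ⟩
    (f x x + row) + (sum (map (λ u → f u x) xs) + crossSum f xs xs)
      ≡⟨ cong₂ (λ a b → (a + row) + (b + crossSum f xs xs)) (f-self x) (sum-map-cong xs (λ u _ → f-comm u x)) ⟩
    row + (row + crossSum f xs xs)
      ≡⟨ cong (λ s → row + (row + s)) (crossSum-diagonal f f-comm f-self xs) ⟩
    row + (row + 2 * pairSum f xs)
      ≡⟨ double row (pairSum f xs) ⟩
    2 * (row + pairSum f xs) ∎
    where
    open ≡-Reasoning
    row = sum (map (f x) xs)
    double : ∀ a s → a + (a + 2 * s) ≡ 2 * (a + s)
    double = solve-∀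

  pairSum-cong : ∀ {f g : Pt → Pt → ℕ} xs → (∀ u v → u ∈ xs → v ∈ xs → f u v ≡ g u v) →
    pairSum f xs ≡ pairSum g xs
  pairSum-cong []       f≡g = refl
  pairSum-cong (x ∷ xs) f≡g =
    cong₂ _+_ (sum-map-cong xs (λ v v∈xs → f≡g x v (here refl) (there v∈xs)))
              (pairSum-cong xs (λ u v u∈xs v∈xs → f≡g u v (there u∈xs) (there v∈xs)))

module DistanceSums where

  open import Data.Nat using (ℕ; zero; suc; _+_; _*_; _∸_; _≤_; _<_; ∣_-_∣)
  open import Data.Nat.Properties
  open import Data.Integer as ℤ using (ℤ; +_)
    renaming (_+_ to _+ᶻ_; _-_ to _-ᶻ_; _*_ to _*ᶻ_)
  import Data.Integer.Properties as ℤ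
  open import Data.Product using (_,_)
  open import Data.Sum using (inj₁; inj₂)
  open import Data.List using (List; []; _++_; applyUpTo; length)
  open import Data.List.Properties using (length-++; length-applyUpTo)
  open import Data.Nat.Tactic.RingSolver using (solve-∀)
  open import Data.Integer.Tactic.RingSolver using () renaming (solve-∀ to solve-∀ᶻ)
  open import Relation.Binary.PropositionalEquality
  open import Defs using (Pt)
  open Summation
  open ListSums using (crossSum; crossSum-++ˡ; crossSum-++ʳ; crossSum-applyUpTo; crossSum-comm)
  open ClosedForms

  manhattan : Pt → Pt → ℕ
  manhattan (x₁ , y₁) (x₂ , y₂) = ℤ.∣ x₁ -ᶻ x₂ ∣ + ℤ.∣ y₁ -ᶻ y₂ ∣

  manhattan-comm : ∀ u v → manhattan u v ≡ manhattan v u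
  manhattan-comm (x₁ , y₁) (x₂ , y₂) = cong₂ _+_ (ℤ.∣i-j∣≡∣j-i∣ x₁ x₂) (ℤ.∣i-j∣≡∣j-i∣ y₁ y₂)

  ∣i-i∣≡0 : ∀ i → ℤ.∣ i -ᶻ i ∣ ≡ 0
  ∣i-i∣≡0 i = cong ℤ.∣_∣ (ℤ.+-inverseʳ i)

  manhattan-self : ∀ u → manhattan u u ≡ 0
  manhattan-self (x , y) = cong₂ _+_ (∣i-i∣≡0 x) (∣i-i∣≡0 y)

  ∣+m-+n∣≡∣m-n∣ : ∀ m n → ℤ.∣ + m -ᶻ + n ∣ ≡ ∣ m - n ∣
  ∣+m-+n∣≡∣m-n∣ m n with ≤-total m n
  ... | inj₁ m≤n = begin
    ℤ.∣ + m -ᶻ + n ∣  ≡⟨ cong ℤ.∣_∣ (ℤ.m-n≡m⊖n m n) ⟩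
    ℤ.∣ m ℤ.⊖ n ∣     ≡⟨ ℤ.∣⊖∣-≤ m≤n ⟩
    n ∸ m             ≡⟨ m≤n⇒∣m-n∣≡n∸m m≤n ⟨
    ∣ m - n ∣         ∎
    where open ≡-Reasoning
  ... | inj₂ n≤m = begin
    ℤ.∣ + m -ᶻ + n ∣  ≡⟨ cong ℤ.∣_∣ (ℤ.m-n≡m⊖n m n) ⟩
    ℤ.∣ m ℤ.⊖ n ∣     ≡⟨ ℤ.∣m⊖n∣≡∣n⊖m∣ m n ⟩
    ℤ.∣ n ℤ.⊖ m ∣     ≡⟨ ℤ.∣⊖∣-≤ n≤m ⟩
    m ∸ n             ≡⟨ m≤n⇒∣n-m∣≡n∸m n≤m ⟨
    ∣ m - n ∣         ∎
    where open ≡-Reasoning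

  ∣+m-+[m+n]∣≡n : ∀ m n → ℤ.∣ + m -ᶻ + (m + n) ∣ ≡ n
  ∣+m-+[m+n]∣≡n m n = trans (∣+m-+n∣≡∣m-n∣ m (m + n)) (∣m-m+n∣≡n m n)

  -- Vertex row k of H(q) and its mirror image, row 2q - 1 - k, both consist of the points
  -- x = -k, ..., q + k.
  width : ℕ → ℕ → ℕ
  width q k = suc (q + k + k)

  row : ℕ → ℕ → ℤ → List Pt
  row q k y = applyUpTo (λ i → (+ i -ᶻ + k , y)) (width q k)

  mirrorRow : ℕ → ℕ → ℕ
  mirrorRow q k = (q ∸ suc k) + q

  rowPair : ℕ → ℕ → List Pt
  rowPair q k = row q k (+ k) ++ row q k (+ mirrorRow q k)

  length-row : ∀ q k y → length (row q k y) ≡ width q k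
  length-row q k y = length-applyUpTo (λ i → (+ i -ᶻ + k , y)) (width q k)

  hexagon : ℕ → ℕ → List Pt
  hexagon q zero    = []
  hexagon q (suc n) = hexagon q n ++ rowPair q n

  length-hexagon : ∀ q n → length (hexagon q n) ≡ 2 * (n * (q + n))
  length-hexagon q zero    = refl
  length-hexagon q (suc n) = begin
    length (hexagon q n ++ rowPair q n)
      ≡⟨ length-++ (hexagon q n) ⟩
    length (hexagon q n) + length (rowPair q n)
      ≡⟨ cong₂ _+_ (length-hexagon q n)
                   (trans (length-++ (row q n (+ n))) (cong₂ _+_ (length-row q n _) (length-row q n _))) ⟩
    2 * (n * (q + n)) + (width q n + width q n)
      ≡⟨ grow q n ⟩
    2 * (suc n * (q + suc n)) ∎
    where
    open ≡-Reasoning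
    grow : ∀ q n → 2 * (n * (q + n)) + (suc (q + n + n) + suc (q + n + n)) ≡ 2 * (suc n * (q + suc n))
    grow = solve-∀

  xSum : ℕ → ℕ → ℕ → ℕ
  xSum q k n = ∑[ i < width q k ] ∑[ j < width q n ] ℤ.∣ (+ i -ᶻ + k) -ᶻ (+ j -ᶻ + n) ∣

  crossSum-row : ∀ q k n y y′ →
    crossSum manhattan (row q k y) (row q n y′) ≡ xSum q k n + width q k * (width q n * ℤ.∣ y -ᶻ y′ ∣)
  crossSum-row q k n y y′ = begin
    crossSum manhattan (row q k y) (row q n y′)
      ≡⟨ crossSum-applyUpTo manhattan (λ i → (+ i -ᶻ + k , y)) wk (λ j → (+ j -ᶻ + n , y′)) wn ⟩
    ∑[ i < wk ] ∑[ j < wn ] (δ i j + c)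
      ≡⟨ ∑-cong wk (λ i → ∑-+ wn (δ i) (λ _ → c)) ⟩
    ∑[ i < wk ] (∑[ j < wn ] δ i j + ∑[ j < wn ] c)
      ≡⟨ ∑-+ wk (λ i → ∑[ j < wn ] δ i j) (λ _ → ∑[ j < wn ] c) ⟩
    xSum q k n + ∑[ i < wk ] ∑[ j < wn ] c
      ≡⟨ cong (_+_ (xSum q k n)) (trans (∑-cong wk (λ _ → ∑-const wn c)) (∑-const wk (wn * c))) ⟩
    xSum q k n + wk * (wn * c) ∎
    where
    open ≡-Reasoning
    wk : ℕ
    wk = width q k
    wn : ℕ
    wn = width q n
    c : ℕ
    c = ℤ.∣ y -ᶻ y′ ∣
    δ : ℕ → ℕ → ℕ
    δ i j = ℤ.∣ (+ i -ᶻ + k) -ᶻ (+ j -ᶻ + n) ∣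

  -- Row k + d extends row k by d points on either side.
  xSum-nested : ∀ q k d → xSum q k (k + d) + 2 * triangularSum d ≡ 2 * triangularSum (d + width q k)
  xSum-nested q k d = begin
    xSum q k (k + d) + 2 * Te d
      ≡⟨ cong (λ x → x + 2 * Te d) (∑-cong W (λ i → ∑-inner i)) ⟩
    ∑[ i < W ] ∑[ j < d + W + d ] ∣ i + d - j ∣ + 2 * Te d
      ≡⟨ +-double _ (Te d) ⟩
    ∑[ i < W ] ∑[ j < d + W + d ] ∣ i + d - j ∣ + Te d + Te d
      ≡⟨ ∑∣i-j∣-segment d W d ⟩
    Te (d + W) + Te (W + d)
      ≡⟨ cong (λ x → Te (d + W) + Te x) (+-comm W d) ⟩
    Te (d + W) + Te (d + W)
      ≡⟨ +-double 0 (Te (d + W)) ⟨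
    2 * Te (d + W) ∎
    where
    open ≡-Reasoning
    Te : ℕ → ℕ
    Te = triangularSum
    W : ℕ
    W = width q k
    +-double : ∀ x t → x + 2 * t ≡ x + t + t
    +-double = solve-∀
    widen : ∀ q k d → suc (q + (k + d) + (k + d)) ≡ d + suc (q + k + k) + d
    widen = solve-∀
    shift : ∀ i k d j → (i -ᶻ k) -ᶻ (j -ᶻ (k +ᶻ d)) ≡ (i +ᶻ d) -ᶻ j
    shift = solve-∀ᶻ
    ∑-inner : ∀ i → ∑[ j < width q (k + d) ] ℤ.∣ (+ i -ᶻ + k) -ᶻ (+ j -ᶻ + (k + d)) ∣
                      ≡ ∑[ j < d + W + d ] ∣ i + d - j ∣
    ∑-inner i = trans (cong (λ l → ∑[ j < l ] ℤ.∣ (+ i -ᶻ + k) -ᶻ (+ j -ᶻ + (k + d)) ∣) (widen q k d))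
                      (∑-cong (d + W + d) (λ j → trans (cong ℤ.∣_∣ (shift (+ i) (+ k) (+ d) (+ j)))
                                                       (∣+m-+n∣≡∣m-n∣ (i + d) j)))

  triangularSum-closed : ∀ n → + (6 * triangularSum n) ≡ cube (+ n)
  triangularSum-closed zero    = refl
  triangularSum-closed (suc n) = begin
    + (6 * (triangularSum n + triangular n))
      ≡⟨ cong +_ (split (triangularSum n) (triangular n)) ⟩
    + (6 * triangularSum n) +ᶻ + (3 * (2 * triangular n))
      ≡⟨ cong₂ _+ᶻ_ (triangularSum-closed n) (cong (λ t → + (3 * t)) (triangular-closed n)) ⟩
    cube (+ n) +ᶻ + (3 * (n * suc n))
      ≡⟨ cong (_+ᶻ_ (cube (+ n))) (trans (ℤ.pos-* 3 (n * suc n)) (cong (+ 3 *ᶻ_) (ℤ.pos-* n (suc n)))) ⟩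
    cube (+ n) +ᶻ + 3 *ᶻ (+ n *ᶻ + suc n)
      ≡⟨ cube-suc (+ n) ⟨
    cube (+ suc n) ∎
    where
    open ≡-Reasoning
    split : ∀ a b → 6 * (a + b) ≡ 6 * a + 3 * (2 * b)
    split = solve-∀

  xSum-closed : ∀ q k d → + (3 * xSum q k (k + d)) ≡ cube (+ (d + width q k)) -ᶻ cube (+ d)
  xSum-closed q k d = begin
    + (3 * X)                                   ≡⟨ cancel (+ (3 * X)) (+ (6 * Te d)) ⟩
    + (3 * X + 6 * Te d) -ᶻ + (6 * Te d)        ≡⟨ cong (λ t → + t -ᶻ + (6 * Te d)) sixfold ⟩
    + (6 * Te N) -ᶻ + (6 * Te d)                ≡⟨ cong₂ _-ᶻ_ (triangularSum-closed N) (triangularSum-closed d) ⟩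
    cube (+ N) -ᶻ cube (+ d)                    ∎
    where
    open ≡-Reasoning
    X : ℕ
    X = xSum q k (k + d)
    Te : ℕ → ℕ
    Te = triangularSum
    N : ℕ
    N = d + width q k
    cancel : ∀ a b → a ≡ (a +ᶻ b) -ᶻ b
    cancel = solve-∀ᶻ
    distrib : ∀ x t → 3 * x + 6 * t ≡ 3 * (x + 2 * t)
    distrib = solve-∀
    sixfold : 3 * X + 6 * Te d ≡ 6 * Te N
    sixfold = trans (distrib X (Te d)) (trans (cong (3 *_) (xSum-nested q k d)) (sym (*-assoc 3 2 (Te N))))

  rowPairSum : ℕ → ℕ → ℕ → ℕ
  rowPairSum q k n = crossSum manhattan (rowPair q k) (rowPair q n)

  ∣+m-+n∣≡c : ∀ m n c → m + c ≡ n → ℤ.∣ + m -ᶻ + n ∣ ≡ c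
  ∣+m-+n∣≡c m _ c refl = ∣+m-+[m+n]∣≡n m c

  ∣+n-+m∣≡c : ∀ m n c → m + c ≡ n → ℤ.∣ + n -ᶻ + m ∣ ≡ c
  ∣+n-+m∣≡c m n c m+c≡n = trans (ℤ.∣i-j∣≡∣j-i∣ (+ n) (+ m)) (∣+m-+n∣≡c m n c m+c≡n)

  -- With n = k + d and q = n + 1 + e, the heights k, 2q - 1 - k of one pair and n, 2q - 1 - n of
  -- the other differ by d, c, c and d.
  rowPairSum-split : ∀ k d e → let q = suc (k + d) + e ; n = k + d ; c = suc (d + e + e) in
    rowPairSum q k n ≡ 4 * xSum q k n + width q k * (width q n * (d + c + c + d))
  rowPairSum-split k d e = begin
    crossSum manhattan (lowₖ ++ highₖ) (lowₙ ++ highₙ)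
      ≡⟨ crossSum-++ˡ manhattan lowₖ highₖ (lowₙ ++ highₙ) ⟩
    crossSum manhattan lowₖ (lowₙ ++ highₙ) + crossSum manhattan highₖ (lowₙ ++ highₙ)
      ≡⟨ cong₂ _+_ (crossSum-++ʳ manhattan lowₖ lowₙ highₙ) (crossSum-++ʳ manhattan highₖ lowₙ highₙ) ⟩
    (crossSum manhattan lowₖ lowₙ + crossSum manhattan lowₖ highₙ)
      + (crossSum manhattan highₖ lowₙ + crossSum manhattan highₖ highₙ)
      ≡⟨ cong₂ _+_ (cong₂ _+_ (crossSum-row q k n _ _) (crossSum-row q k n _ _))
                   (cong₂ _+_ (crossSum-row q k n _ _) (crossSum-row q k n _ _)) ⟩
    (term ℤ.∣ + k -ᶻ + n ∣ + term ℤ.∣ + k -ᶻ + mirrorRow q n ∣)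
      + (term ℤ.∣ + mirrorRow q k -ᶻ + n ∣ + term ℤ.∣ + mirrorRow q k -ᶻ + mirrorRow q n ∣)
      ≡⟨ cong₂ _+_ (cong₂ _+_ (cong term low-low) (cong term low-high))
                   (cong₂ _+_ (cong term high-low) (cong term high-high)) ⟩
    (term d + term c) + (term c + term d)
      ≡⟨ collect X wk wn d c ⟩
    4 * X + wk * (wn * (d + c + c + d)) ∎
    where
    open ≡-Reasoning
    q : ℕ
    q = suc (k + d) + e
    n : ℕ
    n = k + d
    c : ℕ
    c = suc (d + e + e)
    X : ℕ
    X = xSum q k n
    wk : ℕ
    wk = width q k
    wn : ℕ
    wn = width q n
    term : ℕ → ℕ
    term δ = X + wk * (wn * δ)
    lowₖ : List Pt
    lowₖ = row q k (+ k)
    highₖ : List Pt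
    highₖ = row q k (+ mirrorRow q k)
    lowₙ : List Pt
    lowₙ = row q n (+ n)
    highₙ : List Pt
    highₙ = row q n (+ mirrorRow q n)
    below-n : q ∸ suc n ≡ e
    below-n = m+n∸m≡n (suc (k + d)) e
    below-k : q ∸ suc k ≡ d + e
    below-k = trans (cong (_∸ k) (+-assoc k d e)) (m+n∸m≡n k (d + e))
    low-low : ℤ.∣ + k -ᶻ + n ∣ ≡ d
    low-low = ∣+m-+[m+n]∣≡n k d
    low-high : ℤ.∣ + k -ᶻ + mirrorRow q n ∣ ≡ c
    low-high = ∣+m-+n∣≡c k _ c (trans (eq k d e) (cong (_+ q) (sym below-n)))
      where
      eq : ∀ k d e → k + suc (d + e + e) ≡ e + (suc (k + d) + e)
      eq = solve-∀
    high-low : ℤ.∣ + mirrorRow q k -ᶻ + n ∣ ≡ c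
    high-low = ∣+n-+m∣≡c n _ c (trans (eq k d e) (cong (_+ q) (sym below-k)))
      where
      eq : ∀ k d e → k + d + suc (d + e + e) ≡ d + e + (suc (k + d) + e)
      eq = solve-∀
    high-high : ℤ.∣ + mirrorRow q k -ᶻ + mirrorRow q n ∣ ≡ d
    high-high = ∣+n-+m∣≡c (mirrorRow q n) _ d
                  (trans (cong (λ t → t + q + d) below-n) (trans (eq k d e) (cong (_+ q) (sym below-k))))
      where
      eq : ∀ k d e → e + (suc (k + d) + e) + d ≡ d + e + (suc (k + d) + e)
      eq = solve-∀
    collect : ∀ X a b d c → (X + a * (b * d) + (X + a * (b * c))) + (X + a * (b * c) + (X + a * (b * d)))
                              ≡ 4 * X + a * (b * (d + c + c + d))
    collect = solve-∀

  rowPairSum-closed : ∀ q k n → k ≤ n → n < q → + (3 * rowPairSum q k n) ≡ rowPairFormula (+ q) (+ k) (+ n)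
  rowPairSum-closed q k n k≤n n<q with m≤n⇒∃[o]m+o≡n k≤n | m≤n⇒∃[o]m+o≡n n<q
  ... | d , refl | e , refl = begin
    + (3 * rowPairSum q k n)
      ≡⟨ cong (λ t → + (3 * t)) (rowPairSum-split k d e) ⟩
    + (3 * (4 * X + wk * (wn * s)))
      ≡⟨ cong +_ (regroup X (wk * (wn * s))) ⟩
    + (4 * (3 * X)) +ᶻ + (3 * (wk * (wn * s)))
      ≡⟨ cong₂ _+ᶻ_ (ℤ.pos-* 4 (3 * X)) (pos-*³ 3 wk wn s) ⟩
    + 4 *ᶻ + (3 * X) +ᶻ + 3 *ᶻ (+ wk *ᶻ (+ wn *ᶻ + s))
      ≡⟨ cong (λ t → + 4 *ᶻ t +ᶻ + 3 *ᶻ (+ wk *ᶻ (+ wn *ᶻ + s))) (xSum-closed q k d) ⟩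
    + 4 *ᶻ (cube (+ (d + wk)) -ᶻ cube (+ d)) +ᶻ + 3 *ᶻ (+ wk *ᶻ (+ wn *ᶻ + s))
      ≡⟨ rowPairFormula-split (+ k) (+ d) (+ e) ⟩
    rowPairFormula (+ q) (+ k) (+ n) ∎
    where
    open ≡-Reasoning
    X : ℕ
    X = xSum q k n
    wk : ℕ
    wk = width q k
    wn : ℕ
    wn = width q n
    c : ℕ
    c = suc (d + e + e)
    s : ℕ
    s = d + c + c + d
    regroup : ∀ x y → 3 * (4 * x + y) ≡ 4 * (3 * x) + 3 * y
    regroup = solve-∀
    pos-*³ : ∀ a b c d → + (a * (b * (c * d))) ≡ + a *ᶻ (+ b *ᶻ (+ c *ᶻ + d))
    pos-*³ a b c d = trans (ℤ.pos-* a _) (cong (+ a *ᶻ_) (trans (ℤ.pos-* b _) (cong (+ b *ᶻ_) (ℤ.pos-* c d))))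

  partialSum : ℕ → ℕ → ℕ → ℕ
  partialSum q n m = ∑[ k < m ] rowPairSum q k n

  partialSum-closed : ∀ q n m → m ≤ n → n < q → + (3 * partialSum q n m) ≡ partialFormula (+ q) (+ n) (+ m)
  partialSum-closed q n zero    _   _   = sym (partialFormula-zero (+ q) (+ n))
  partialSum-closed q n (suc m) m<n n<q = begin
    + (3 * partialSum q n (suc m))
      ≡⟨ cong (λ t → + (3 * t)) (∑-suc m (λ k → rowPairSum q k n)) ⟩
    + (3 * (partialSum q n m + rowPairSum q m n))
      ≡⟨ cong +_ (*-distribˡ-+ 3 (partialSum q n m) (rowPairSum q m n)) ⟩
    + (3 * partialSum q n m) +ᶻ + (3 * rowPairSum q m n)
      ≡⟨ cong₂ _+ᶻ_ (partialSum-closed q n m (<⇒≤ m<n) n<q) (rowPairSum-closed q m n (<⇒≤ m<n) n<q) ⟩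
    partialFormula (+ q) (+ n) (+ m) +ᶻ rowPairFormula (+ q) (+ m) (+ n)
      ≡⟨ partialFormula-suc (+ q) (+ n) (+ m) ⟨
    partialFormula (+ q) (+ n) (+ suc m) ∎
    where open ≡-Reasoning

  hexagonSum : ℕ → ℕ → ℕ
  hexagonSum q n = crossSum manhattan (hexagon q n) (hexagon q n)

  crossSum-hexagon : ∀ q n zs → crossSum manhattan (hexagon q n) zs ≡ ∑[ k < n ] crossSum manhattan (rowPair q k) zs
  crossSum-hexagon q zero    zs = refl
  crossSum-hexagon q (suc n) zs = begin
    crossSum manhattan (hexagon q n ++ rowPair q n) zs
      ≡⟨ crossSum-++ˡ manhattan (hexagon q n) (rowPair q n) zs ⟩
    crossSum manhattan (hexagon q n) zs + crossSum manhattan (rowPair q n) zs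
      ≡⟨ cong (λ t → t + crossSum manhattan (rowPair q n) zs) (crossSum-hexagon q n zs) ⟩
    ∑[ k < n ] crossSum manhattan (rowPair q k) zs + crossSum manhattan (rowPair q n) zs
      ≡⟨ ∑-suc n (λ k → crossSum manhattan (rowPair q k) zs) ⟨
    ∑[ k < suc n ] crossSum manhattan (rowPair q k) zs ∎
    where open ≡-Reasoning

  hexagonSum-suc : ∀ q n → hexagonSum q (suc n) ≡ hexagonSum q n + 2 * partialSum q n n + rowPairSum q n n
  hexagonSum-suc q n = begin
    crossSum manhattan (H ++ R) (H ++ R)
      ≡⟨ crossSum-++ˡ manhattan H R (H ++ R) ⟩
    crossSum manhattan H (H ++ R) + crossSum manhattan R (H ++ R)
      ≡⟨ cong₂ _+_ (crossSum-++ʳ manhattan H H R) (crossSum-++ʳ manhattan R H R) ⟩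
    (hexagonSum q n + crossSum manhattan H R) + (crossSum manhattan R H + rowPairSum q n n)
      ≡⟨ cong (λ t → (hexagonSum q n + crossSum manhattan H R) + (t + rowPairSum q n n))
              (crossSum-comm manhattan manhattan-comm R H) ⟩
    (hexagonSum q n + crossSum manhattan H R) + (crossSum manhattan H R + rowPairSum q n n)
      ≡⟨ cong (λ t → (hexagonSum q n + t) + (t + rowPairSum q n n)) (crossSum-hexagon q n R) ⟩
    (hexagonSum q n + partialSum q n n) + (partialSum q n n + rowPairSum q n n)
      ≡⟨ regroup (hexagonSum q n) (partialSum q n n) (rowPairSum q n n) ⟩
    hexagonSum q n + 2 * partialSum q n n + rowPairSum q n n ∎
    where
    open ≡-Reasoning
    H : List Pt
    H = hexagon q n
    R : List Pt
    R = rowPair q n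
    regroup : ∀ a b c → (a + b) + (b + c) ≡ a + 2 * b + c
    regroup = solve-∀

  hexagonSum-closed : ∀ q n → n ≤ q → + (15 * hexagonSum q n) ≡ hexagonFormula (+ q) (+ n)
  hexagonSum-closed q zero    _   = sym (hexagonFormula-zero (+ q))
  hexagonSum-closed q (suc n) n<q = begin
    + (15 * hexagonSum q (suc n))
      ≡⟨ cong (λ t → + (15 * t)) (hexagonSum-suc q n) ⟩
    + (15 * (hexagonSum q n + 2 * partialSum q n n + rowPairSum q n n))
      ≡⟨ cong +_ (regroup (hexagonSum q n) (partialSum q n n) (rowPairSum q n n)) ⟩
    + (15 * hexagonSum q n) +ᶻ + (10 * (3 * partialSum q n n)) +ᶻ + (5 * (3 * rowPairSum q n n))
      ≡⟨ cong₂ (λ a b → + (15 * hexagonSum q n) +ᶻ a +ᶻ b)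
               (ℤ.pos-* 10 (3 * partialSum q n n)) (ℤ.pos-* 5 (3 * rowPairSum q n n)) ⟩
    + (15 * hexagonSum q n) +ᶻ + 10 *ᶻ + (3 * partialSum q n n) +ᶻ + 5 *ᶻ + (3 * rowPairSum q n n)
      ≡⟨ cong₂ (λ a b → a +ᶻ + 10 *ᶻ b +ᶻ + 5 *ᶻ + (3 * rowPairSum q n n))
               (hexagonSum-closed q n (<⇒≤ n<q)) (partialSum-closed q n n ≤-refl n<q) ⟩
    hexagonFormula (+ q) (+ n) +ᶻ + 10 *ᶻ partialFormula (+ q) (+ n) (+ n) +ᶻ + 5 *ᶻ + (3 * rowPairSum q n n)
      ≡⟨ cong (λ t → hexagonFormula (+ q) (+ n) +ᶻ + 10 *ᶻ partialFormula (+ q) (+ n) (+ n) +ᶻ + 5 *ᶻ t)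
              (rowPairSum-closed q n n ≤-refl n<q) ⟩
    hexagonFormula (+ q) (+ n) +ᶻ + 10 *ᶻ partialFormula (+ q) (+ n) (+ n) +ᶻ + 5 *ᶻ rowPairFormula (+ q) (+ n) (+ n)
      ≡⟨ hexagonFormula-suc (+ q) (+ n) ⟨
    hexagonFormula (+ q) (+ suc n) ∎
    where
    open ≡-Reasoning
    regroup : ∀ a b c → 15 * (a + 2 * b + c) ≡ 15 * a + 10 * (3 * b) + 5 * (3 * c)
    regroup = solve-∀

module Cells where

  open import Data.Nat using (ℕ; suc; _+_; _*_; _∸_; _≤_; _<_; s≤s; s<s; _<ᵇ_; _≡ᵇ_)
  open import Data.Nat.Properties
  open import Data.Integer as ℤ using (ℤ; +_; -_)
    renaming (_+_ to _+ᶻ_; _-_ to _-ᶻ_)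
  import Data.Integer.Properties as ℤ
  open import Data.Bool using (true; false; T; if_then_else_)
  open import Data.Unit using (tt)
  open import Data.Empty using (⊥-elim)
  open import Data.Product using (_×_; _,_; Σ)
  open import Data.Sum using (_⊎_; inj₁; inj₂)
  open import Data.List using (map; applyUpTo)
  open import Data.List.Properties using (map-applyUpTo)
  open import Data.List.Membership.Propositional using (_∈_; find; lose)
  open import Data.List.Relation.Unary.Any using (here; there)
  open import Data.List.Membership.Propositional.Properties
    using (∈-applyUpTo⁺; ∈-applyUpTo⁻; ∈-concatMap⁺; ∈-concatMap⁻)
  open import Data.Nat.Tactic.RingSolver using (solve-∀)
  open import Data.Integer.Tactic.RingSolver using () renaming (solve-∀ to solve-∀ᶻ)
  open import Relation.Nullary using (¬_; yes; no)
  open import Relation.Binary.PropositionalEquality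
  open import Defs
  open Summation using (applyUpTo-cong)
  open DistanceSums using (width; row)

  if-true : ∀ {A : Set} {b} {x y : A} → T b → (if b then x else y) ≡ x
  if-true {b = true} _ = refl

  if-false : ∀ {A : Set} {b} {x y : A} → ¬ T b → (if b then x else y) ≡ y
  if-false {b = false} _  = refl
  if-false {b = true}  ¬t = ⊥-elim (¬t tt)

  ¬<ᵇ : ∀ {m n} → n ≤ m → ¬ T (m <ᵇ n)
  ¬<ᵇ {m} {n} n≤m t = <⇒≱ (<ᵇ⇒< m n t) n≤m

  nP≡ : ∀ a → nP (suc a) ≡ suc (a + a + a)
  nP≡ a = cong (_∸ 2) (triple a)
    where
    triple : ∀ a → 3 * suc a ≡ 2 + suc (a + a + a)
    triple = solve-∀

  CellRowBounds : ℕ → ℕ → ℕ → Set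
  CellRowBounds a r k = Lrow (suc a) r ≡ - + k × Rrow (suc a) r ≡ + a +ᶻ + k

  lowerCellRow : ∀ a k → k < a → CellRowBounds a k k
  lowerCellRow a k k<a = if-true (<⇒<ᵇ k<a) , trans (if-true (<⇒<ᵇ k<a)) (shift (+ a) (+ k))
    where
    shift : ∀ a k → (+ 1 +ᶻ a) -ᶻ + 1 +ᶻ k ≡ a +ᶻ k
    shift = solve-∀ᶻ

  middleCellRow : ∀ a → CellRowBounds a a a
  middleCellRow a = middle , trans middle (trans (cong (λ n → - + a +ᶻ + n -ᶻ + 1) (nP≡ a)) (span (+ a)))
    where
    middle : ∀ {A : Set} {x y z : A} → (if a <ᵇ a then x else if a ≡ᵇ a then y else z) ≡ y
    middle = trans (if-false {b = a <ᵇ a} (¬<ᵇ {a} ≤-refl)) (if-true (≡⇒≡ᵇ a a refl))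
    span : ∀ a → - a +ᶻ (+ 1 +ᶻ (a +ᶻ a +ᶻ a)) -ᶻ + 1 ≡ a +ᶻ a
    span = solve-∀ᶻ

  upperCellRow : ∀ k l → let a = k + suc l in CellRowBounds a (suc l + a) k
  upperCellRow k l =
    trans upper (trans (cong (λ m → + 1 -ᶻ + a +ᶻ + m) r∸a≡l) (left (+ k) (+ l))) ,
    trans upper (trans (cong₂ (λ n m → + n -ᶻ + 2 -ᶻ + a -ᶻ + m) (nP≡ a) r∸a≡l) (right (+ k) (+ l)))
    where
    a : ℕ
    a = k + suc l
    r : ℕ
    r = suc l + a
    upper : ∀ {A : Set} {x y z : A} → (if r <ᵇ a then x else if r ≡ᵇ a then y else z) ≡ z
    upper = trans (if-false {b = r <ᵇ a} (¬<ᵇ (m≤n+m a (suc l))))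
                  (if-false {b = r ≡ᵇ a} (λ t → <⇒≢ (s≤s (m≤n+m a l)) (sym (≡ᵇ⇒≡ r a t))))
    r∸a≡l : r ∸ (a + 1) ≡ l
    r∸a≡l = trans (cong (r ∸_) (+-comm a 1)) (m+n∸n≡m l a)
    left : ∀ k l → + 1 -ᶻ (k +ᶻ (+ 1 +ᶻ l)) +ᶻ l ≡ - k
    left = solve-∀ᶻ
    right : ∀ k l → let a = k +ᶻ (+ 1 +ᶻ l) in (+ 1 +ᶻ (a +ᶻ a +ᶻ a)) -ᶻ + 2 -ᶻ a -ᶻ l ≡ a +ᶻ k
    right = solve-∀ᶻ

  -- The lower-left corners of the cells of H(a + 1) are the points of Hex a a,
  -- and its vertices those of Hex a (a + 1).
  record Hex (a q : ℕ) (x y : ℤ) : Set where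
    constructor hex
    field
      k i : ℕ
      k≤a : k ≤ a
      i<w : i < width q k
      x≡ : x ≡ + i -ᶻ + k
      y≡ : y ≡ + k ⊎ y ≡ + ((a ∸ k) + q)

  <⇒∃+suc : ∀ {m n} → m < n → Σ ℕ λ l → m + suc l ≡ n
  <⇒∃+suc {m} m<n with m≤n⇒∃[o]m+o≡n m<n
  ... | l , e = l , trans (+-suc m l) e

  CellRow : ℕ → ℕ → ℕ → Set
  CellRow a k r = r ≡ k ⊎ r ≡ (a ∸ k) + a

  mirror-self : ∀ a → (a ∸ a) + a ≡ a
  mirror-self a = cong (_+ a) (n∸n≡0 a)

  cellRow-bounds : ∀ a k r → k ≤ a → CellRow a k r → CellRowBounds a r k
  cellRow-bounds a k r k≤a side with m≤n⇒m<n∨m≡n k≤a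
  cellRow-bounds a k _ _ (inj₁ refl) | inj₂ refl = middleCellRow k
  cellRow-bounds a k _ _ (inj₂ refl) | inj₂ refl = subst (λ r → CellRowBounds k r k) (sym (mirror-self k)) (middleCellRow k)
  cellRow-bounds a k _ _ (inj₁ refl) | inj₁ k<a = lowerCellRow a k k<a
  cellRow-bounds a k _ _ (inj₂ refl) | inj₁ k<a with <⇒∃+suc k<a
  ... | l , refl = subst (λ r → CellRowBounds (k + suc l) r k) (cong (_+ (k + suc l)) (sym a∸k≡)) (upperCellRow k l)
    where
    a∸k≡ : k + suc l ∸ k ≡ suc l
    a∸k≡ = m+n∸m≡n k (suc l)

  2a+1≡ : ∀ a → 2 * a + 1 ≡ suc (a + a)
  2a+1≡ = solve-∀

  cellRow< : ∀ a k r → k ≤ a → CellRow a k r → r < 2 * a + 1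
  cellRow< a k r k≤a side = subst (r <_) (sym (2a+1≡ a)) (s≤s (bound side))
    where
    bound : CellRow a k r → r ≤ a + a
    bound (inj₁ refl) = ≤-trans k≤a (m≤m+n a a)
    bound (inj₂ refl) = +-monoˡ-≤ a (m∸n≤m a k)

  cellRow-index : ∀ a r → r < 2 * a + 1 → Σ ℕ λ k → k ≤ a × CellRow a k r
  cellRow-index a r r< with r ≤? a
  ... | yes r≤a = r , r≤a , inj₁ refl
  ... | no r≰a with m≤n⇒∃[o]m+o≡n (≰⇒> r≰a)
  ... | l , refl = a ∸ suc l , m∸n≤m a (suc l) ,
                   inj₂ (sym (trans (cong (_+ a) (m∸[m∸n]≡n l<a)) (cong suc (+-comm l a))))
    where
    l<a : suc l ≤ a
    l<a = +-cancelˡ-≤ a (suc l) a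
            (subst (_≤ a + a) (sym (+-suc a l)) (≤-pred (subst (suc (suc a + l) ≤_) (2a+1≡ a) r<)))

  rowCells≡row : ∀ a r k → CellRowBounds a r k → rowCells (suc a) r ≡ row a k (+ r)
  rowCells≡row a r k (L≡ , R≡) = begin
    map (λ x → (x , + r)) (zrange L (ℤ.∣ R -ᶻ L ∣ + 1))
      ≡⟨ cong₂ (λ s n → map (λ x → (x , + r)) (zrange s n)) L≡ (trans (cong (λ z → ℤ.∣ z ∣ + 1) span) (+-comm _ 1)) ⟩
    map (λ x → (x , + r)) (zrange (- + k) (width a k))
      ≡⟨ map-applyUpTo (λ i → - + k +ᶻ + i) (λ x → (x , + r)) (width a k) ⟩
    applyUpTo (λ i → (- + k +ᶻ + i , + r)) (width a k)
      ≡⟨ applyUpTo-cong (λ i → cong (_, + r) (ℤ.+-comm (- + k) (+ i))) (width a k) ⟩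
    row a k (+ r) ∎
    where
    open ≡-Reasoning
    L : ℤ
    L = Lrow (suc a) r
    R : ℤ
    R = Rrow (suc a) r
    widthᶻ : ∀ a k → (a +ᶻ k) -ᶻ (- k) ≡ a +ᶻ k +ᶻ k
    widthᶻ = solve-∀ᶻ
    span : R -ᶻ L ≡ + (a + k + k)
    span = trans (cong₂ _-ᶻ_ R≡ L≡) (widthᶻ (+ a) (+ k))

  ∈-row⁻ : ∀ q k {y′ x y} → (x , y) ∈ row q k y′ → Σ ℕ λ i → i < width q k × x ≡ + i -ᶻ + k × y ≡ y′
  ∈-row⁻ q k {y′} u∈ with ∈-applyUpTo⁻ (λ i → (+ i -ᶻ + k , y′)) u∈
  ... | i , i<w , refl = i , i<w , refl , refl

  ∈-row⁺ : ∀ q k {i} y → i < width q k → (+ i -ᶻ + k , y) ∈ row q k y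
  ∈-row⁺ q k y i<w = ∈-applyUpTo⁺ (λ i → (+ i -ᶻ + k , y)) i<w

  ∈-cells⁻ : ∀ a {x y} → (x , y) ∈ cells (suc a) → Hex a a x y
  ∈-cells⁻ a c∈ with find (∈-concatMap⁻ (rowCells (suc a)) c∈)
  ... | r , r∈ , c∈r with ∈-applyUpTo⁻ (λ r → r) r∈
  ... | r , r< , refl with cellRow-index a r r<
  ... | k , k≤a , side with ∈-row⁻ a k (subst (_ ∈_) (rowCells≡row a r k (cellRow-bounds a k r k≤a side)) c∈r)
  ... | i , i<w , refl , refl = hex k i k≤a i<w refl (height side)
    where
    height : CellRow a k r → + r ≡ + k ⊎ + r ≡ + ((a ∸ k) + a)
    height (inj₁ refl) = inj₁ refl
    height (inj₂ refl) = inj₂ refl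

  ∈-cellRow : ∀ a {k i} r → k ≤ a → i < width a k → CellRow a k r → (+ i -ᶻ + k , + r) ∈ cells (suc a)
  ∈-cellRow a {k} r k≤a i<w side =
    ∈-concatMap⁺ (rowCells (suc a)) (lose (∈-applyUpTo⁺ (λ r → r) (cellRow< a k r k≤a side))
    (subst (_ ∈_) (sym (rowCells≡row a r k (cellRow-bounds a k r k≤a side))) (∈-row⁺ a k (+ r) i<w)))

  ∈-cells⁺ : ∀ a {x y} → Hex a a x y → (x , y) ∈ cells (suc a)
  ∈-cells⁺ a (hex k i k≤a i<w refl (inj₁ refl)) = ∈-cellRow a k k≤a i<w (inj₁ refl)
  ∈-cells⁺ a (hex k i k≤a i<w refl (inj₂ refl)) = ∈-cellRow a _ k≤a i<w (inj₂ refl)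

  width-suc : ∀ a k → width (suc a) (suc k) ≡ 3 + width a k
  width-suc a k = widen a k
    where
    widen : ∀ a k → suc (suc a + suc k + suc k) ≡ 3 + suc (a + k + k)
    widen = solve-∀

  [i-k]+1≡[1+i]-k : ∀ i k → (+ i -ᶻ + k) +ᶻ + 1 ≡ + suc i -ᶻ + k
  [i-k]+1≡[1+i]-k i k = shift (+ i) (+ k)
    where
    shift : ∀ i k → (i -ᶻ k) +ᶻ + 1 ≡ (+ 1 +ᶻ i) -ᶻ k
    shift = solve-∀ᶻ

  i-k≡[1+i]-[1+k] : ∀ i k → + i -ᶻ + k ≡ + suc i -ᶻ + suc k
  i-k≡[1+i]-[1+k] i k = shift (+ i) (+ k)
    where
    shift : ∀ i k → i -ᶻ k ≡ (+ 1 +ᶻ i) -ᶻ (+ 1 +ᶻ k)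
    shift = solve-∀ᶻ

  [i-k]+1≡[2+i]-[1+k] : ∀ i k → (+ i -ᶻ + k) +ᶻ + 1 ≡ + suc (suc i) -ᶻ + suc k
  [i-k]+1≡[2+i]-[1+k] i k = trans ([i-k]+1≡[1+i]-k i k) (i-k≡[1+i]-[1+k] (suc i) k)

  mirror+1 : ∀ a k → + ((a ∸ k) + a) +ᶻ + 1 ≡ + ((a ∸ k) + suc a)
  mirror+1 a k = cong +_ (trans (+-assoc (a ∸ k) a 1) (cong (_+_ (a ∸ k)) (+-comm a 1)))

  above-middle : ∀ a → + a +ᶻ + 1 ≡ + ((a ∸ a) + suc a)
  above-middle a = cong +_ (trans (+-comm a 1) (cong (_+ suc a) (sym (n∸n≡0 a))))

  mirror-below : ∀ a k → k < a → (a ∸ k) + a ≡ (a ∸ suc k) + suc a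
  mirror-below a k k<a with <⇒∃+suc k<a
  ... | l , refl = begin
    (k + suc l ∸ k) + (k + suc l)          ≡⟨ cong (_+ (k + suc l)) (m+n∸m≡n k (suc l)) ⟩
    suc l + (k + suc l)                    ≡⟨ +-suc l (k + suc l) ⟨
    l + suc (k + suc l)                    ≡⟨ cong (_+ suc (k + suc l)) a∸[1+k]≡l ⟨
    (k + suc l ∸ suc k) + suc (k + suc l)  ∎
    where
    open ≡-Reasoning
    a∸[1+k]≡l : k + suc l ∸ suc k ≡ l
    a∸[1+k]≡l = trans (cong (_∸ suc k) (+-suc k l)) (m+n∸m≡n (suc k) l)

  i<width⇒1+i<width-suc : ∀ a k {i} → i < width a k → suc i < width (suc a) (suc k)
  i<width⇒1+i<width-suc a k {i} i<w = subst (suc i <_) (sym (width-suc a k)) (m<n⇒m<1+n (m<n⇒m<1+n (s<s i<w)))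

  i<width⇒2+i<width-suc : ∀ a k {i} → i < width a k → suc (suc i) < width (suc a) (suc k)
  i<width⇒2+i<width-suc a k {i} i<w = subst (suc (suc i) <_) (sym (width-suc a k)) (s<s (s<s (m<n⇒m<1+n i<w)))

  -- The bottom corners of a cell in row k lie on vertex row k, its top corners on vertex row
  -- k + 1, which for k = a is the mirror row a + 1; symmetrically for the mirrored cell rows.
  corner⇒vertex : ∀ a {cx cy x y} → Hex a a cx cy → (x , y) ∈ corners (cx , cy) → Hex a (suc a) x y
  corner⇒vertex a (hex k i k≤a i<w refl (inj₁ refl)) (here refl) =
    hex k i k≤a (m<n⇒m<1+n i<w) refl (inj₁ refl)
  corner⇒vertex a (hex k i k≤a i<w refl (inj₁ refl)) (there (here refl)) =
    hex k (suc i) k≤a (s<s i<w) ([i-k]+1≡[1+i]-k i k) (inj₁ refl)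
  corner⇒vertex a (hex k i k≤a i<w refl (inj₁ refl)) (there (there (here refl))) with m≤n⇒m<n∨m≡n k≤a
  ... | inj₁ k<a  = hex (suc k) (suc i) k<a (i<width⇒1+i<width-suc a k i<w)
                        (i-k≡[1+i]-[1+k] i k) (inj₁ (cong +_ (+-comm k 1)))
  ... | inj₂ refl = hex k i k≤a (m<n⇒m<1+n i<w) refl (inj₂ (above-middle k))
  corner⇒vertex a (hex k i k≤a i<w refl (inj₁ refl)) (there (there (there (here refl)))) with m≤n⇒m<n∨m≡n k≤a
  ... | inj₁ k<a  = hex (suc k) (suc (suc i)) k<a (i<width⇒2+i<width-suc a k i<w)
                        ([i-k]+1≡[2+i]-[1+k] i k) (inj₁ (cong +_ (+-comm k 1)))
  ... | inj₂ refl = hex k (suc i) k≤a (s<s i<w) ([i-k]+1≡[1+i]-k i k) (inj₂ (above-middle k))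
  corner⇒vertex a (hex k i k≤a i<w refl (inj₂ refl)) (here refl) with m≤n⇒m<n∨m≡n k≤a
  ... | inj₁ k<a  = hex (suc k) (suc i) k<a (i<width⇒1+i<width-suc a k i<w)
                        (i-k≡[1+i]-[1+k] i k) (inj₂ (cong +_ (mirror-below a k k<a)))
  ... | inj₂ refl = hex k i k≤a (m<n⇒m<1+n i<w) refl (inj₁ (cong +_ (mirror-self k)))
  corner⇒vertex a (hex k i k≤a i<w refl (inj₂ refl)) (there (here refl)) with m≤n⇒m<n∨m≡n k≤a
  ... | inj₁ k<a  = hex (suc k) (suc (suc i)) k<a (i<width⇒2+i<width-suc a k i<w)
                        ([i-k]+1≡[2+i]-[1+k] i k) (inj₂ (cong +_ (mirror-below a k k<a)))
  ... | inj₂ refl = hex k (suc i) k≤a (s<s i<w) ([i-k]+1≡[1+i]-k i k) (inj₁ (cong +_ (mirror-self k)))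
  corner⇒vertex a (hex k i k≤a i<w refl (inj₂ refl)) (there (there (here refl))) =
    hex k i k≤a (m<n⇒m<1+n i<w) refl (inj₂ (mirror+1 a k))
  corner⇒vertex a (hex k i k≤a i<w refl (inj₂ refl)) (there (there (there (here refl)))) =
    hex k (suc i) k≤a (s<s i<w) ([i-k]+1≡[1+i]-k i k) (inj₂ (mirror+1 a k))

  vertex⇒corner : ∀ a {x y} → Hex a (suc a) x y →
    Σ ℤ λ cx → Σ ℤ λ cy → Hex a a cx cy × (x , y) ∈ corners (cx , cy)
  vertex⇒corner a (hex k i k≤a i<w refl (inj₁ refl)) with m≤n⇒m<n∨m≡n (≤-pred i<w)
  ... | inj₁ i<w′ = _ , _ , hex k i k≤a i<w′ refl (inj₁ refl) , here refl
  ... | inj₂ refl = _ , _ , hex k (a + k + k) k≤a ≤-refl refl (inj₁ refl) ,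
                    there (here (cong (_, + k) (sym ([i-k]+1≡[1+i]-k (a + k + k) k))))
  vertex⇒corner a (hex k i k≤a i<w refl (inj₂ refl)) with m≤n⇒m<n∨m≡n (≤-pred i<w)
  ... | inj₁ i<w′ = _ , _ , hex k i k≤a i<w′ refl (inj₂ refl) ,
                    there (there (here (cong (+ i -ᶻ + k ,_) (sym (mirror+1 a k)))))
  ... | inj₂ refl = _ , _ , hex k (a + k + k) k≤a ≤-refl refl (inj₂ refl) ,
                    there (there (there (here (cong₂ _,_ (sym ([i-k]+1≡[1+i]-k (a + k + k) k)) (sym (mirror+1 a k))))))

module Vertices where

  open import Data.Nat using (ℕ; zero; suc; _+_; _≤_; _<_; s≤s)
  open import Data.Nat.Properties
  open import Data.Integer as ℤ using (ℤ; +_)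
    renaming (_+_ to _+ᶻ_; _-_ to _-ᶻ_)
  import Data.Integer.Properties as ℤ
  open import Data.Empty using (⊥)
  open import Data.Product using (_×_; _,_; Σ; proj₁)
  open import Data.Sum using (_⊎_; inj₁; inj₂)
  open import Data.List using (concatMap)
  open import Data.List.Membership.Propositional using (_∈_; find; lose)
  open import Data.List.Membership.Propositional.Properties
    using (∈-++⁻; ∈-++⁺ˡ; ∈-++⁺ʳ; ∈-concatMap⁺; ∈-concatMap⁻; ∈-deduplicate⁻; ∈-deduplicate⁺)
  open import Data.List.Membership.Propositional.Properties.WithK using (unique∧set⇒bag)
  open import Data.List.Relation.Binary.BagAndSetEquality using (∼bag⇒↭)
  open import Data.List.Relation.Binary.Permutation.Propositional using (_↭_)
  open import Data.List.Relation.Unary.Unique.Propositional using (Unique)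
  open import Data.List.Relation.Unary.Unique.Propositional.Properties using (++⁺; applyUpTo⁺₁)
  open import Defs
  open import Data.List.Relation.Unary.Unique.DecPropositional.Properties _≟P_ using (deduplicate-!)
  open import Data.List.Relation.Unary.AllPairs using ([])
  open import Function.Bundles using (mk⇔)
  open import Data.Integer.Tactic.RingSolver using () renaming (solve-∀ to solve-∀ᶻ)
  open import Relation.Nullary using (¬_)
  open import Relation.Binary.PropositionalEquality
  open DistanceSums using (width; row; mirrorRow; rowPair; hexagon)
  open Cells

  ∈-rowPair⁻ : ∀ q k {x y} → (x , y) ∈ rowPair q k →
    Σ ℕ λ i → i < width q k × x ≡ + i -ᶻ + k × (y ≡ + k ⊎ y ≡ + mirrorRow q k)
  ∈-rowPair⁻ q k u∈ with ∈-++⁻ (row q k (+ k)) u∈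
  ... | inj₁ u∈low with ∈-row⁻ q k u∈low
  ...   | i , i<w , x≡ , y≡ = i , i<w , x≡ , inj₁ y≡
  ∈-rowPair⁻ q k u∈ | inj₂ u∈high with ∈-row⁻ q k u∈high
  ...   | i , i<w , x≡ , y≡ = i , i<w , x≡ , inj₂ y≡

  ∈-hexagon⁻ : ∀ q n {u} → u ∈ hexagon q n → Σ ℕ λ k → k < n × u ∈ rowPair q k
  ∈-hexagon⁻ q (suc n) u∈ with ∈-++⁻ (hexagon q n) u∈
  ... | inj₁ u∈H with ∈-hexagon⁻ q n u∈H
  ...   | k , k<n , u∈R = k , m<n⇒m<1+n k<n , u∈R
  ∈-hexagon⁻ q (suc n) u∈ | inj₂ u∈R = n , n<1+n n , u∈R

  ∈-hexagon⁺ : ∀ q n {k u} → k < n → u ∈ rowPair q k → u ∈ hexagon q n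
  ∈-hexagon⁺ q (suc n) {k} k<1+n u∈R with m<1+n⇒m<n∨m≡n k<1+n
  ... | inj₁ k<n  = ∈-++⁺ˡ (∈-hexagon⁺ q n k<n u∈R)
  ... | inj₂ refl = ∈-++⁺ʳ (hexagon q k) u∈R

  ∈-hexagon⇒Hex : ∀ a {x y} → (x , y) ∈ hexagon (suc a) (suc a) → Hex a (suc a) x y
  ∈-hexagon⇒Hex a u∈ with ∈-hexagon⁻ (suc a) (suc a) u∈
  ... | k , k<p , u∈R with ∈-rowPair⁻ (suc a) k u∈R
  ...   | i , i<w , x≡ , y≡ = hex k i (≤-pred k<p) i<w x≡ y≡

  Hex⇒∈-hexagon : ∀ a {x y} → Hex a (suc a) x y → (x , y) ∈ hexagon (suc a) (suc a)
  Hex⇒∈-hexagon a (hex k i k≤a i<w refl (inj₁ refl)) =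
    ∈-hexagon⁺ (suc a) (suc a) (s≤s k≤a) (∈-++⁺ˡ (∈-row⁺ (suc a) k (+ k) i<w))
  Hex⇒∈-hexagon a (hex k i k≤a i<w refl (inj₂ refl)) =
    ∈-hexagon⁺ (suc a) (suc a) (s≤s k≤a) (∈-++⁺ʳ (row (suc a) k (+ k)) (∈-row⁺ (suc a) k _ i<w))

  ∈-vertices⇒Hex : ∀ a {x y} → (x , y) ∈ vertices (suc a) → Hex a (suc a) x y
  ∈-vertices⇒Hex a u∈
    with find (∈-concatMap⁻ corners (∈-deduplicate⁻ _≟P_ (concatMap corners (cells (suc a))) u∈))
  ... | (cx , cy) , c∈ , u∈c = corner⇒vertex a (∈-cells⁻ a c∈) u∈c

  Hex⇒∈-vertices : ∀ a {x y} → Hex a (suc a) x y → (x , y) ∈ vertices (suc a)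
  Hex⇒∈-vertices a h with vertex⇒corner a h
  ... | cx , cy , c , u∈c = ∈-deduplicate⁺ _≟P_ (∈-concatMap⁺ corners (lose (∈-cells⁺ a c) u∈c))

  row-injective : ∀ {i j k} → + i -ᶻ + k ≡ + j -ᶻ + k → i ≡ j
  row-injective {i} {j} {k} eq = ℤ.+-injective (begin
    + i                  ≡⟨ cancel (+ i) (+ k) ⟩
    (+ i -ᶻ + k) +ᶻ + k  ≡⟨ cong (_+ᶻ + k) eq ⟩
    (+ j -ᶻ + k) +ᶻ + k  ≡⟨ cancel (+ j) (+ k) ⟨
    + j                  ∎)
    where
    open ≡-Reasoning
    cancel : ∀ i k → i ≡ (i -ᶻ k) +ᶻ k
    cancel = solve-∀ᶻ

  Unique-row : ∀ q k y → Unique (row q k y)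
  Unique-row q k y =
    applyUpTo⁺₁ (λ i → (+ i -ᶻ + k , y)) (width q k) (λ i<j _ eq → <⇒≢ i<j (row-injective {k = k} (cong proj₁ eq)))

  mirrorRow-injective : ∀ {q k n} → k < q → n < q → mirrorRow q k ≡ mirrorRow q n → k ≡ n
  mirrorRow-injective {q} k<q n<q eq = suc-injective (∸-cancelˡ-≡ k<q n<q (+-cancelʳ-≡ q _ _ eq))

  RowPairHeight : ℕ → ℕ → ℤ → Set
  RowPairHeight q k y = y ≡ + k ⊎ y ≡ + mirrorRow q k

  rowPairHeights-disjoint : ∀ {q k n y} → k < n → n < q → RowPairHeight q k y → RowPairHeight q n y → ⊥
  rowPairHeights-disjoint k<n n<q (inj₁ refl) (inj₁ eq) = <⇒≢ k<n (ℤ.+-injective eq)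
  rowPairHeights-disjoint {q} k<n n<q (inj₁ refl) (inj₂ eq) =
    <⇒≢ (<-≤-trans (<-trans k<n n<q) (m≤n+m q _)) (ℤ.+-injective eq)
  rowPairHeights-disjoint {q} k<n n<q (inj₂ refl) (inj₁ eq) =
    <⇒≢ (<-≤-trans n<q (m≤n+m q _)) (sym (ℤ.+-injective eq))
  rowPairHeights-disjoint k<n n<q (inj₂ refl) (inj₂ eq) =
    <⇒≢ k<n (mirrorRow-injective (<-trans k<n n<q) n<q (ℤ.+-injective eq))

  Unique-rowPair : ∀ q k → k < q → Unique (rowPair q k)
  Unique-rowPair q k k<q = ++⁺ (Unique-row q k (+ k)) (Unique-row q k (+ mirrorRow q k)) disjoint
    where
    disjoint : ∀ {u} → ¬ (u ∈ row q k (+ k) × u ∈ row q k (+ mirrorRow q k))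
    disjoint {x , y} (u∈low , u∈high) with ∈-row⁻ q k u∈low | ∈-row⁻ q k u∈high
    ... | _ , _ , _ , refl | _ , _ , _ , eq = <⇒≢ (<-≤-trans k<q (m≤n+m q _)) (ℤ.+-injective eq)

  Unique-hexagon : ∀ q n → n ≤ q → Unique (hexagon q n)
  Unique-hexagon q zero    _   = []
  Unique-hexagon q (suc n) n<q = ++⁺ (Unique-hexagon q n (<⇒≤ n<q)) (Unique-rowPair q n n<q) disjoint
    where
    disjoint : ∀ {u} → ¬ (u ∈ hexagon q n × u ∈ rowPair q n)
    disjoint {x , y} (u∈H , u∈R) with ∈-hexagon⁻ q n u∈H
    ... | k , k<n , u∈Rₖ with ∈-rowPair⁻ q k u∈Rₖ | ∈-rowPair⁻ q n u∈R
    ... | _ , _ , _ , hₖ | _ , _ , _ , hₙ = rowPairHeights-disjoint k<n n<q hₖ hₙ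

  vertices↭hexagon : ∀ a → vertices (suc a) ↭ hexagon (suc a) (suc a)
  vertices↭hexagon a =
    ∼bag⇒↭ (unique∧set⇒bag (deduplicate-! _) (Unique-hexagon (suc a) (suc a) ≤-refl) (mk⇔ to from))
    where
    to : ∀ {u} → u ∈ vertices (suc a) → u ∈ hexagon (suc a) (suc a)
    to {x , y} u∈ = Hex⇒∈-hexagon a (∈-vertices⇒Hex a u∈)
    from : ∀ {u} → u ∈ hexagon (suc a) (suc a) → u ∈ vertices (suc a)
    from {x , y} u∈ = Hex⇒∈-vertices a (∈-hexagon⇒Hex a u∈)

module Walks where

  open import Data.Nat using (ℕ; zero; suc; _+_; _∸_; _≤_; _⊓_; s≤s; _≤?_)
  open import Data.Nat.Properties
  open import Data.Integer as ℤ using (ℤ; +_; -_; +≤+)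
    renaming (_+_ to _+ᶻ_; _-_ to _-ᶻ_; _≤_ to _≤ᶻ_)
  import Data.Integer.Properties as ℤ
  open import Data.Product using (_×_; _,_; Σ; proj₁)
  open import Data.Sum using (inj₁; inj₂; swap)
  open import Data.List.Membership.Propositional using (_∈_; lose)
  open import Data.List.Relation.Unary.Any as Any using (here; there)
  open import Data.Nat.Tactic.RingSolver using (solve-∀)
  open import Data.Integer.Tactic.RingSolver using () renaming (solve-∀ to solve-∀ᶻ)
  open import Relation.Nullary using (yes; no)
  open import Relation.Binary.PropositionalEquality
  open import Defs
  open import Algebra.Properties.CommutativeSemigroup +-commutativeSemigroup using (interchange)
  open DistanceSums using (manhattan; manhattan-comm; manhattan-self; ∣i-i∣≡0; ∣+m-+[m+n]∣≡n)
  open Cells using (Hex; hex; CellRow; ∈-cellRow)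
  open Vertices using (∈-vertices⇒Hex)

  ≤ᶻ⇒∃ : ∀ {i j} → i ≤ᶻ j → Σ ℕ λ n → j ≡ i +ᶻ + n
  ≤ᶻ⇒∃ {i} {j} i≤j =
    ℤ.∣ j -ᶻ i ∣ , trans (sym (i+[j-i]≡j i j)) (cong (i +ᶻ_) (sym (ℤ.0≤i⇒+∣i∣≡i (ℤ.i≤j⇒0≤j-i i≤j))))
    where
    i+[j-i]≡j : ∀ i j → i +ᶻ (j -ᶻ i) ≡ j
    i+[j-i]≡j = solve-∀ᶻ

  ∃⇒≤ᶻ : ∀ {i j} n → j ≡ i +ᶻ + n → i ≤ᶻ j
  ∃⇒≤ᶻ {i} n refl = ℤ.i≤i+j i (+ n)

  segment⁺ : ∀ m k {i} → i ≤ m + k + k → - + k ≤ᶻ + i -ᶻ + k × + i -ᶻ + k ≤ᶻ + m +ᶻ + k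
  segment⁺ m k {i} i≤ with m≤n⇒∃[o]m+o≡n i≤
  ... | d , i+d≡ =
    ∃⇒≤ᶻ i (shiftˡ (+ k) (+ i)) ,
    ∃⇒≤ᶻ d (trans (unshift (+ m) (+ k)) (trans (cong (λ n → + n -ᶻ + k) (sym i+d≡)) (shiftʳ (+ i) (+ d) (+ k))))
    where
    shiftˡ : ∀ k i → i -ᶻ k ≡ - k +ᶻ i
    shiftˡ = solve-∀ᶻ
    shiftʳ : ∀ i d k → (i +ᶻ d) -ᶻ k ≡ i -ᶻ k +ᶻ d
    shiftʳ = solve-∀ᶻ
    unshift : ∀ m k → m +ᶻ k ≡ m +ᶻ k +ᶻ k -ᶻ k
    unshift = solve-∀ᶻ

  segment⁻ : ∀ m k {x} → - + k ≤ᶻ x → x ≤ᶻ + m +ᶻ + k → Σ ℕ λ i → i ≤ m + k + k × x ≡ + i -ᶻ + k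
  segment⁻ m k lo hi with ≤ᶻ⇒∃ lo | ≤ᶻ⇒∃ hi
  ... | i , refl | d , m+k≡ = i , subst (i ≤_) (ℤ.+-injective (sym total)) (m≤m+n i d) , reorder (+ k) (+ i)
    where
    cancel : ∀ k i d → (- k +ᶻ i) +ᶻ d +ᶻ k ≡ i +ᶻ d
    cancel = solve-∀ᶻ
    reorder : ∀ k i → - k +ᶻ i ≡ i -ᶻ k
    reorder = solve-∀ᶻ
    total : + (m + k + k) ≡ + (i + d)
    total = trans (cong (_+ᶻ + k) m+k≡) (cancel (+ k) (+ i) (+ d))

  -- Vertex row y ≤ 2a + 1 of H(a + 1) consists of the points x = -reach a y, ..., a + 1 + reach a y.
  reach : ℕ → ℕ → ℕ
  reach a y = y ⊓ (suc (a + a) ∸ y)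

  reach-lower : ∀ a y → y ≤ a → reach a y ≡ y
  reach-lower a y y≤a = m≤n⇒m⊓n≡m (m+n≤o⇒m≤o∸n y (≤-trans (+-mono-≤ y≤a y≤a) (n≤1+n (a + a))))

  reach-upper : ∀ k j → reach (k + j) (suc (k + j) + j) ≡ k
  reach-upper k j =
    trans (cong (_⊓_ (suc (k + j) + j)) rest) (m≥n⇒m⊓n≡n (≤-trans (m≤m+n k j) (≤-trans (m≤m+n (k + j) j) (n≤1+n _))))
    where
    regroup : ∀ k j → (k + j) + (k + j) ≡ (k + j + j) + k
    regroup = solve-∀
    rest : suc ((k + j) + (k + j)) ∸ (suc (k + j) + j) ≡ k
    rest = trans (cong (_∸ (k + j + j)) (regroup k j)) (m+n∸m≡n (k + j + j) k)

  InShape : ℕ → ℤ → ℕ → Set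
  InShape a x y = y ≤ suc (a + a) × - + reach a y ≤ᶻ x × x ≤ᶻ + suc a +ᶻ + reach a y

  Hex⇒InShape : ∀ a {x y} → Hex a (suc a) x y → Σ ℕ λ y′ → y ≡ + y′ × InShape a x y′
  Hex⇒InShape a (hex k i k≤a i<w refl (inj₁ refl)) =
    k , refl , ≤-trans k≤a (≤-trans (m≤m+n a a) (n≤1+n _)) ,
    subst (λ r → - + r ≤ᶻ _ × _ ≤ᶻ + suc a +ᶻ + r) (sym (reach-lower a k k≤a)) (segment⁺ (suc a) k (≤-pred i<w))
  Hex⇒InShape a (hex k i k≤a i<w refl (inj₂ refl)) with m≤n⇒∃[o]m+o≡n k≤a
  ... | j , refl = _ , cong +_ y≡ , y≤ ,
    subst (λ r → - + r ≤ᶻ _ × _ ≤ᶻ + suc a′ +ᶻ + r) (sym (reach-upper k j)) (segment⁺ (suc a′) k (≤-pred i<w))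
    where
    a′ : ℕ
    a′ = k + j
    y≡ : (a′ ∸ k) + suc a′ ≡ suc a′ + j
    y≡ = trans (cong (_+ suc a′) (m+n∸m≡n k j)) (trans (+-suc j a′) (cong suc (+-comm j a′)))
    y≤ : suc a′ + j ≤ suc (a′ + a′)
    y≤ = s≤s (+-monoʳ-≤ a′ (m≤n+m j k))

  InShape-widen : ∀ a {x y y′} → reach a y ≤ reach a y′ → y′ ≤ suc (a + a) → InShape a x y → InShape a x y′
  InShape-widen a r≤r′ y′≤ (_ , lo , hi) =
    y′≤ , ℤ.≤-trans (ℤ.neg-mono-≤ (+≤+ r≤r′)) lo , ℤ.≤-trans hi (ℤ.+-monoʳ-≤ (+ suc a) (+≤+ r≤r′))

  reach-convex : ∀ a {y₁ y y₂} → y₁ ≤ y → y ≤ y₂ → reach a y₁ ⊓ reach a y₂ ≤ reach a y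
  reach-convex a {y₁} {y} {y₂} y₁≤y y≤y₂ =
    ⊓-glb (≤-trans (m⊓n≤m _ _) (≤-trans (m⊓n≤m y₁ _) y₁≤y))
          (≤-trans (m⊓n≤n _ _) (≤-trans (m⊓n≤n y₂ _) (∸-monoʳ-≤ (suc (a + a)) y≤y₂)))

  InShape-between : ∀ a {x y₁ y y₂} → y₁ ≤ y → y ≤ y₂ → InShape a x y₁ → InShape a x y₂ → InShape a x y
  InShape-between a {y₁ = y₁} {y} {y₂} y₁≤y y≤y₂ s₁ s₂ with ⊓-sel (reach a y₁) (reach a y₂)
  ... | inj₁ eq = InShape-widen a (subst (_≤ reach a y) eq (reach-convex a y₁≤y y≤y₂)) (≤-trans y≤y₂ (proj₁ s₂)) s₁
  ... | inj₂ eq = InShape-widen a (subst (_≤ reach a y) eq (reach-convex a y₁≤y y≤y₂)) (≤-trans y≤y₂ (proj₁ s₂)) s₂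

  data VertexRow : ℕ → ℕ → Set where
    lower : ∀ {a y} → y ≤ a → VertexRow a y
    upper : ∀ k j → VertexRow (k + j) (suc (k + j) + j)

  vertexRow : ∀ a y → y ≤ suc (a + a) → VertexRow a y
  vertexRow a y y≤ with y ≤? a
  ... | yes y≤a = lower y≤a
  ... | no y≰a with m≤n⇒∃[o]m+o≡n (≰⇒> y≰a)
  ... | j , refl with m≤n⇒∃[o]m+o≡n (+-cancelˡ-≤ a j a (≤-pred y≤))
  ... | k , j+k≡a rewrite sym (trans (+-comm k j) j+k≡a) = upper k j

  cellAt : ∀ a {k r x} → k ≤ a → CellRow a k r → - + k ≤ᶻ x → x ≤ᶻ + a +ᶻ + k → (x , + r) ∈ cells (suc a)
  cellAt a {k} {r} k≤a side lo hi with segment⁻ a k lo hi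
  ... | i , i≤ , refl = ∈-cellRow a r k≤a (s≤s i≤) side

  x+1≤⇒x≤ : ∀ a k {x} → x +ᶻ + 1 ≤ᶻ + suc a +ᶻ + k → x ≤ᶻ + a +ᶻ + k
  x+1≤⇒x≤ a k {x} hi with ≤ᶻ⇒∃ hi
  ... | d , e = ∃⇒≤ᶻ d (trans (drop₁ (+ a) (+ k)) (trans (cong (_-ᶻ + 1) e) (drop₂ x (+ d))))
    where
    drop₁ : ∀ a k → a +ᶻ k ≡ (+ 1 +ᶻ a) +ᶻ k -ᶻ + 1
    drop₁ = solve-∀ᶻ
    drop₂ : ∀ x d → x +ᶻ + 1 +ᶻ d -ᶻ + 1 ≡ x +ᶻ d
    drop₂ = solve-∀ᶻ

  bottomSide : ∀ a {k r x} → k ≤ a → CellRow a k r → - + k ≤ᶻ x → x +ᶻ + 1 ≤ᶻ + suc a +ᶻ + k →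
    Adj (suc a) (x , + r) (x +ᶻ + 1 , + r)
  bottomSide a {k} k≤a side lo hi = lose (cellAt a k≤a side lo (x+1≤⇒x≤ a k hi)) (inj₁ (here refl))

  topSide : ∀ a {k r x} → k ≤ a → CellRow a k r → - + k ≤ᶻ x → x +ᶻ + 1 ≤ᶻ + suc a +ᶻ + k →
    Adj (suc a) (x , + r +ᶻ + 1) (x +ᶻ + 1 , + r +ᶻ + 1)
  topSide a {k} k≤a side lo hi = lose (cellAt a k≤a side lo (x+1≤⇒x≤ a k hi)) (inj₁ (there (here refl)))

  -- The right end x = a + 1 + k of a row is the right side of the last cell, every other x a left side.
  verticalSide : ∀ a {k r x} → k ≤ a → CellRow a k r → - + k ≤ᶻ x → x ≤ᶻ + suc a +ᶻ + k →
    Adj (suc a) (x , + r) (x , + r +ᶻ + 1)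
  verticalSide a {k} {r} {x} k≤a side lo hi with ≤ᶻ⇒∃ hi
  ... | suc d , e = lose (cellAt a k≤a side lo (x+1≤⇒x≤ a k (∃⇒≤ᶻ d (trans e (sym (ℤ.+-assoc x (+ 1) (+ d)))))))
                         (inj₁ (there (there (here refl))))
  ... | zero , e = lose (∈-cellRow a r k≤a ≤-refl side)
                        (inj₁ (there (there (there (here (cong₂ _,_ (cong (_, + r) x≡) (cong (_, + r +ᶻ + 1) x≡)))))))
    where
    last : ∀ a k → (a +ᶻ k +ᶻ k -ᶻ k) +ᶻ + 1 ≡ (+ 1 +ᶻ a) +ᶻ k
    last = solve-∀ᶻ
    x≡ : x ≡ (+ (a + k + k) -ᶻ + k) +ᶻ + 1
    x≡ = trans (sym (ℤ.+-identityʳ x)) (trans (sym e) (sym (last (+ a) (+ k))))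

  horizontalEdge : ∀ a {x y} → InShape a x y → InShape a (x +ᶻ + 1) y → Adj (suc a) (x , + y) (x +ᶻ + 1 , + y)
  horizontalEdge a {x} {y} (y≤ , lo , _) (_ , _ , hi) with vertexRow a y y≤
  ... | lower y≤a = bottomSide a y≤a (inj₁ refl)
                      (subst (λ r → - + r ≤ᶻ x) (reach-lower a y y≤a) lo)
                      (subst (λ r → x +ᶻ + 1 ≤ᶻ + suc a +ᶻ + r) (reach-lower a y y≤a) hi)
  ... | upper k j = subst (λ Y → Adj (suc (k + j)) (x , Y) (x +ᶻ + 1 , Y)) (cong +_ r+1≡y)
                      (topSide (k + j) (m≤m+n k j) (inj₂ refl)
                        (subst (λ r → - + r ≤ᶻ x) (reach-upper k j) lo)
                        (subst (λ r → x +ᶻ + 1 ≤ᶻ + suc (k + j) +ᶻ + r) (reach-upper k j) hi))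
    where
    r+1≡y : (k + j ∸ k) + (k + j) + 1 ≡ suc (k + j) + j
    r+1≡y = trans (cong (λ m → m + (k + j) + 1) (m+n∸m≡n k j)) (lemma j k)
      where
      lemma : ∀ j k → j + (k + j) + 1 ≡ suc (k + j) + j
      lemma = solve-∀

  verticalEdge : ∀ a {x y} → InShape a x y → InShape a x (suc y) → Adj (suc a) (x , + y) (x , + suc y)
  verticalEdge a {x} {y} (_ , lo , hi) (y′≤ , lo′ , hi′) with vertexRow a (suc y) y′≤
  ... | lower y<a = subst (λ Y → Adj (suc a) (x , + y) (x , Y)) (cong +_ (+-comm y 1))
                      (verticalSide a (<⇒≤ y<a) (inj₁ refl)
                        (subst (λ r → - + r ≤ᶻ x) (reach-lower a y (<⇒≤ y<a)) lo)
                        (subst (λ r → x ≤ᶻ + suc a +ᶻ + r) (reach-lower a y (<⇒≤ y<a)) hi))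
  ... | upper k j = subst (λ Y → Adj (suc (k + j)) (x , + (k + j + j)) (x , Y)) (cong +_ (+-comm (k + j + j) 1))
                      (verticalSide (k + j) (m≤m+n k j) (inj₂ row≡)
                        (subst (λ r → - + r ≤ᶻ x) (reach-upper k j) lo′)
                        (subst (λ r → x ≤ᶻ + suc (k + j) +ᶻ + r) (reach-upper k j) hi′))
    where
    row≡ : k + j + j ≡ (k + j ∸ k) + (k + j)
    row≡ = trans (+-comm (k + j) j) (cong (_+ (k + j)) (sym (m+n∸m≡n k j)))

  _++ʷ_ : ∀ {p u w v m n} → Walk p u w m → Walk p w v n → Walk p u v (m + n)
  here       ++ʷ walk = walk
  step e rest ++ʷ walk = step e (rest ++ʷ walk)

  Adj-sym : ∀ {p u v} → Adj p u v → Adj p v u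
  Adj-sym = Any.map swap

  reverseʷ : ∀ {p u v n} → Walk p u v n → Walk p v u n
  reverseʷ here = here
  reverseʷ {p} (step {k = k} e rest) = subst (Walk p _ _) (+-comm k 1) (reverseʷ rest ++ʷ step (Adj-sym {p} e) here)

  horizontalWalk : ∀ a n {x y} → InShape a x y → InShape a (x +ᶻ + n) y → Walk (suc a) (x , + y) (x +ᶻ + n , + y) n
  horizontalWalk a zero    {x} {y} _ _ = subst (λ z → Walk (suc a) (x , + y) (z , + y) 0) (sym (ℤ.+-identityʳ x)) here
  horizontalWalk a (suc n) {x} {y} s₀@(y≤ , lo , _) sₙ@(_ , _ , hi) =
    step (horizontalEdge a s₀ s₁) (subst (λ z → Walk (suc a) (x +ᶻ + 1 , + y) (z , + y) n) (sym x+[1+n]≡)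
                                         (horizontalWalk a n s₁ (subst (λ z → InShape a z y) x+[1+n]≡ sₙ)))
    where
    x+[1+n]≡ : x +ᶻ + suc n ≡ (x +ᶻ + 1) +ᶻ + n
    x+[1+n]≡ = sym (ℤ.+-assoc x (+ 1) (+ n))
    s₁ : InShape a (x +ᶻ + 1) y
    s₁ = y≤ , ℤ.≤-trans lo (∃⇒≤ᶻ 1 refl) , ℤ.≤-trans (∃⇒≤ᶻ n x+[1+n]≡) hi

  verticalWalk : ∀ a n {x y} → InShape a x y → InShape a x (y + n) → Walk (suc a) (x , + y) (x , + (y + n)) n
  verticalWalk a zero    {x} {y} _ _ = subst (λ z → Walk (suc a) (x , + y) (x , + z) 0) (sym (+-identityʳ y)) here
  verticalWalk a (suc n) {x} {y} s₀ sₙ =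
    step (verticalEdge a s₀ s₁) (subst (λ z → Walk (suc a) (x , + suc y) (x , + z) n) (sym (+-suc y n))
                                       (verticalWalk a n s₁ (subst (InShape a x) (+-suc y n) sₙ)))
    where
    s₁ : InShape a x (suc y)
    s₁ = InShape-between a (n≤1+n y) (subst (suc y ≤_) (sym (+-suc y n)) (s≤s (m≤m+n y n))) s₀ sₙ

  ∣x-[x+n]∣≡n : ∀ x n → ℤ.∣ x -ᶻ (x +ᶻ + n) ∣ ≡ n
  ∣x-[x+n]∣≡n x n = trans (cong ℤ.∣_∣ (negate x (+ n))) (ℤ.∣-i∣≡∣i∣ (+ n))
    where
    negate : ∀ x n → x -ᶻ (x +ᶻ n) ≡ - n
    negate = solve-∀ᶻ

  rowWalk : ∀ a {x₁ x₂ y} → InShape a x₁ y → InShape a x₂ y → Walk (suc a) (x₁ , + y) (x₂ , + y) ℤ.∣ x₁ -ᶻ x₂ ∣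
  rowWalk a {x₁} {x₂} {y} s₁ s₂ with ℤ.≤-total x₁ x₂
  ... | inj₁ x₁≤x₂ with ≤ᶻ⇒∃ x₁≤x₂
  ...   | n , refl = subst (Walk (suc a) _ _) (sym (∣x-[x+n]∣≡n x₁ n)) (horizontalWalk a n s₁ s₂)
  rowWalk a {x₁} {x₂} {y} s₁ s₂ | inj₂ x₂≤x₁ with ≤ᶻ⇒∃ x₂≤x₁
  ...   | n , refl = subst (Walk (suc a) _ _) (trans (sym (∣x-[x+n]∣≡n x₂ n)) (ℤ.∣i-j∣≡∣j-i∣ x₂ _))
                           (reverseʷ (horizontalWalk a n s₂ s₁))

  columnWalk : ∀ a {x y₁ y₂} → y₁ ≤ y₂ → InShape a x y₁ → InShape a x y₂ →
    Walk (suc a) (x , + y₁) (x , + y₂) ℤ.∣ + y₁ -ᶻ + y₂ ∣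
  columnWalk a {x} {y₁} y₁≤y₂ s₁ s₂ with m≤n⇒∃[o]m+o≡n y₁≤y₂
  ... | n , refl = subst (Walk (suc a) _ _) (sym (∣+m-+[m+n]∣≡n y₁ n)) (verticalWalk a n s₁ s₂)

  -- Climb first in the column of the endpoint on the narrower row, so that the corner of the
  -- path stays in the hexagon.
  shapeWalk≤ : ∀ a {x₁ y₁ x₂ y₂} → y₁ ≤ y₂ → InShape a x₁ y₁ → InShape a x₂ y₂ →
    Walk (suc a) (x₁ , + y₁) (x₂ , + y₂) (manhattan (x₁ , + y₁) (x₂ , + y₂))
  shapeWalk≤ a {x₁} {y₁} {x₂} {y₂} y₁≤y₂ s₁ s₂ with reach a y₁ ≤? reach a y₂
  ... | yes r₁≤r₂ = subst (Walk (suc a) _ _) (+-comm ℤ.∣ + y₁ -ᶻ + y₂ ∣ ℤ.∣ x₁ -ᶻ x₂ ∣)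
                      (columnWalk a y₁≤y₂ s₁ corner ++ʷ rowWalk a corner s₂)
    where
    corner : InShape a x₁ y₂
    corner = InShape-widen a r₁≤r₂ (proj₁ s₂) s₁
  ... | no r₁≰r₂ = rowWalk a s₁ corner ++ʷ columnWalk a y₁≤y₂ corner s₂
    where
    corner : InShape a x₂ y₁
    corner = InShape-widen a (<⇒≤ (≰⇒> r₁≰r₂)) (proj₁ s₁) s₂

  shapeWalk : ∀ a {x₁ y₁ x₂ y₂} → InShape a x₁ y₁ → InShape a x₂ y₂ →
    Walk (suc a) (x₁ , + y₁) (x₂ , + y₂) (manhattan (x₁ , + y₁) (x₂ , + y₂))
  shapeWalk a {x₁} {y₁} {x₂} {y₂} s₁ s₂ with ≤-total y₁ y₂
  ... | inj₁ y₁≤y₂ = shapeWalk≤ a y₁≤y₂ s₁ s₂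
  ... | inj₂ y₂≤y₁ = subst (Walk (suc a) _ _) (manhattan-comm (x₂ , + y₂) (x₁ , + y₁))
                           (reverseʷ (shapeWalk≤ a y₂≤y₁ s₂ s₁))

  manhattanWalk : ∀ a {u v} → u ∈ vertices (suc a) → v ∈ vertices (suc a) → Walk (suc a) u v (manhattan u v)
  manhattanWalk a {x₁ , _} {x₂ , _} u∈ v∈
    with Hex⇒InShape a (∈-vertices⇒Hex a u∈) | Hex⇒InShape a (∈-vertices⇒Hex a v∈)
  ... | y₁ , refl , s₁ | y₂ , refl , s₂ = shapeWalk a s₁ s₂

  ∣i-k∣≤∣i-j∣+∣j-k∣ : ∀ i j k → ℤ.∣ i -ᶻ k ∣ ≤ ℤ.∣ i -ᶻ j ∣ + ℤ.∣ j -ᶻ k ∣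
  ∣i-k∣≤∣i-j∣+∣j-k∣ i j k =
    subst (λ z → ℤ.∣ z ∣ ≤ ℤ.∣ i -ᶻ j ∣ + ℤ.∣ j -ᶻ k ∣) (telescope i j k) (ℤ.∣i+j∣≤∣i∣+∣j∣ (i -ᶻ j) (j -ᶻ k))
    where
    telescope : ∀ i j k → (i -ᶻ j) +ᶻ (j -ᶻ k) ≡ i -ᶻ k
    telescope = solve-∀ᶻ

  manhattan-triangle : ∀ u w v → manhattan u v ≤ manhattan u w + manhattan w v
  manhattan-triangle (x₁ , y₁) (x₂ , y₂) (x₃ , y₃) =
    ≤-trans (+-mono-≤ (∣i-k∣≤∣i-j∣+∣j-k∣ x₁ x₂ x₃) (∣i-k∣≤∣i-j∣+∣j-k∣ y₁ y₂ y₃))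
            (≤-reflexive (interchange ℤ.∣ x₁ -ᶻ x₂ ∣ ℤ.∣ x₂ -ᶻ x₃ ∣ ℤ.∣ y₁ -ᶻ y₂ ∣ ℤ.∣ y₂ -ᶻ y₃ ∣))

  side⇒manhattan≡1 : ∀ {u v} c → (u , v) ∈ sides c → manhattan u v ≡ 1
  side⇒manhattan≡1 (x , y) (here refl)                         = cong₂ _+_ (∣x-[x+n]∣≡n x 1) (∣i-i∣≡0 y)
  side⇒manhattan≡1 (x , y) (there (here refl))                 = cong₂ _+_ (∣x-[x+n]∣≡n x 1) (∣i-i∣≡0 (y +ᶻ + 1))
  side⇒manhattan≡1 (x , y) (there (there (here refl)))         = cong₂ _+_ (∣i-i∣≡0 x) (∣x-[x+n]∣≡n y 1)
  side⇒manhattan≡1 (x , y) (there (there (there (here refl)))) = cong₂ _+_ (∣i-i∣≡0 (x +ᶻ + 1)) (∣x-[x+n]∣≡n y 1)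

  Adj⇒manhattan≡1 : ∀ {p u v} → Adj p u v → manhattan u v ≡ 1
  Adj⇒manhattan≡1 {p} {u} {v} adj with Any.satisfied adj
  ... | c , inj₁ uv∈ = side⇒manhattan≡1 c uv∈
  ... | c , inj₂ vu∈ = trans (manhattan-comm u v) (side⇒manhattan≡1 c vu∈)

  manhattan≤walk : ∀ {p u v k} → Walk p u v k → manhattan u v ≤ k
  manhattan≤walk {u = u} here = ≤-reflexive (manhattan-self u)
  manhattan≤walk {p} {u} {v} (step {w = w} {k = k} e rest) =
    ≤-trans (manhattan-triangle u w v)
            (subst (λ m → m + manhattan w v ≤ suc k) (sym (Adj⇒manhattan≡1 {p} e)) (s≤s (manhattan≤walk rest)))

  manhattan-isDistance : ∀ a → IsDistance (suc a) manhattan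
  manhattan-isDistance a u v u∈ v∈ = manhattanWalk a u∈ v∈ , λ _ → manhattan≤walk

module WienerIndex where

  open import Data.Nat using (suc; _+_; _*_)
  open import Data.Nat.Properties using (≤-antisym)
  open import Data.Integer using (+_)
    renaming (_*_ to _*ᶻ_)
  import Data.Integer.Properties as ℤ
  open import Data.Product using (proj₁; proj₂)
  open import Data.List using (List; length)
  open import Data.List.Membership.Propositional using (_∈_)
  open import Data.List.Relation.Binary.Permutation.Propositional.Properties using (↭-length)
  open import Data.Nat.Tactic.RingSolver using (solve-∀)
  open import Relation.Binary.PropositionalEquality
  open import Defs
  open ListSums using (crossSum; crossSum-↭; crossSum-diagonal; pairSum-cong)
  open DistanceSums using (manhattan; manhattan-comm; manhattan-self; hexagon; length-hexagon; hexagonSum)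
  open Vertices using (vertices↭hexagon)
  open Walks using (manhattan-isDistance)

  distance-unique : ∀ {p d d′} → IsDistance p d → IsDistance p d′ →
    ∀ {u v} → u ∈ vertices p → v ∈ vertices p → d u v ≡ d′ u v
  distance-unique isD isD′ {u} {v} u∈ v∈ =
    ≤-antisym (proj₂ (isD u v u∈ v∈) _ (proj₁ (isD′ u v u∈ v∈)))
              (proj₂ (isD′ u v u∈ v∈) _ (proj₁ (isD u v u∈ v∈)))

  twice-wiener : ∀ a d → IsDistance (suc a) d → 2 * wiener (suc a) d ≡ hexagonSum (suc a) (suc a)
  twice-wiener a d isD = begin
    2 * pairSum d V
      ≡⟨ cong (2 *_) (pairSum-cong V (λ u v u∈ v∈ → distance-unique isD (manhattan-isDistance a) u∈ v∈)) ⟩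
    2 * pairSum manhattan V
      ≡⟨ crossSum-diagonal manhattan manhattan-comm manhattan-self V ⟨
    crossSum manhattan V V
      ≡⟨ crossSum-↭ manhattan (vertices↭hexagon a) (vertices↭hexagon a) ⟩
    hexagonSum (suc a) (suc a) ∎
    where
    open ≡-Reasoning
    V : List Pt
    V = vertices (suc a)

  length-vertices : ∀ a → + length (vertices (suc a)) ≡ + 4 *ᶻ + suc a *ᶻ + suc a
  length-vertices a = begin
    + length (vertices (suc a))          ≡⟨ cong +_ (↭-length (vertices↭hexagon a)) ⟩
    + length (hexagon (suc a) (suc a))   ≡⟨ cong +_ (trans (length-hexagon (suc a) (suc a)) (quadruple (suc a))) ⟩
    + (4 * suc a * suc a)                ≡⟨ ℤ.pos-* (4 * suc a) (suc a) ⟩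
    + (4 * suc a) *ᶻ + suc a             ≡⟨ cong (_*ᶻ + suc a) (ℤ.pos-* 4 (suc a)) ⟩
    + 4 *ᶻ + suc a *ᶻ + suc a            ∎
    where
    open ≡-Reasoning
    quadruple : ∀ p → 2 * (p * (p + p)) ≡ 4 * p * p
    quadruple = solve-∀

open import Defs
open import Data.Nat using (ℕ; _≤_)
open import Data.Integer using (ℤ; +_; _*_; _-_)
open import Data.List using (length)
open import Data.Product using (_×_; ∃)
open import Relation.Binary.PropositionalEquality using (_≡_)
open import Data.Nat using (suc)
open import Data.Nat.Properties using (≤-refl)
import Data.Integer.Properties as ℤ
open import Data.Product using (_,_)
open import Relation.Binary.PropositionalEquality using (cong; sym; trans; module ≡-Reasoning)
open import Data.Integer.Tactic.RingSolver using (solve-∀)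
open ClosedForms using (hexagonFormula; hexagonFormula-diagonal)
open DistanceSums using (manhattan; hexagonSum; hexagonSum-closed)
open Walks using (manhattan-isDistance)
open WienerIndex using (twice-wiener; length-vertices)

-- The formula also holds for p = 1; the hypothesis 2 ≤ p only excludes p = 0.
mainTheorem6 : (p : ℕ) → 2 ≤ p →
    ∃ (IsDistance p) ×
    (∀ d → IsDistance p d →
      (+ 2) * (+ wiener p d) * ((+ 120) * (+ p) * (+ p) * (+ p) - (+ 30) * (+ p))
        ≡ ((+ 158) * (+ p) * (+ p) * (+ p) * (+ p) - (+ 35) * (+ p) * (+ p) - (+ 3))
          * ((+ length (vertices p)) * ((+ length (vertices p)) - (+ 1))))
mainTheorem6 (suc a) _ = (manhattan , manhattan-isDistance a) , λ d isD → begin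
  + 2 * + wiener p d * C
    ≡⟨ cong (_* C) (trans (sym (ℤ.pos-* 2 (wiener p d))) (cong +_ (twice-wiener a d isD))) ⟩
  + hexagonSum p p * C
    ≡⟨ rescale (+ hexagonSum p p) (+ p) ⟩
  + 15 * + hexagonSum p p * C′
    ≡⟨ cong (_* C′) (trans (sym (ℤ.pos-* 15 (hexagonSum p p))) (hexagonSum-closed p p ≤-refl)) ⟩
  hexagonFormula (+ p) (+ p) * C′
    ≡⟨ hexagonFormula-diagonal (+ p) ⟩
  F * (L * (L - + 1))
    ≡⟨ cong (λ l → F * (l * (l - + 1))) (sym (length-vertices a)) ⟩
  F * (+ length (vertices p) * (+ length (vertices p) - + 1)) ∎
  where
  open ≡-Reasoning
  p : ℕ
  p = suc a
  C : ℤ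
  C = + 120 * + p * + p * + p - + 30 * + p
  C′ : ℤ
  C′ = + 8 * + p * + p * + p - + 2 * + p
  F : ℤ
  F = + 158 * + p * + p * + p * + p - + 35 * + p * + p - + 3
  L : ℤ
  L = + 4 * + p * + p
  rescale : ∀ t p → t * (+ 120 * p * p * p - + 30 * p) ≡ + 15 * t * (+ 8 * p * p * p - + 2 * p)
  rescale = solve-∀
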